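{- $$\sum_{n\ge1}\frac1n\,p_n\big(\Omega_0(tX)\big)=\sum_{n\ge1}H_n t^n.$$
   Context: Let $\Lambda$ be the ring of symmetric functions over $\mathbb{Q}$ in variables $X=(x_1,x_2,\ldots)$, completed with respect to degree; $h_n$, $p_\lambda$ denote complete homogeneous and power sum symmetric functions. For a formal power series $A$ in the $x_i$ and an auxiliary variable $t$, $p_n(A)$ is obtained from $A$ by replacing every variable (including $t$) by its $n$-th power; $F(A)$ for symmetric $F$ is obtained by substituting $p_k\mapsto p_k(A)$. The alphabet $tX$ means $(tx_1,tx_2,\ldots)$. $\Omega(X)=\sum_{n\ge0}h_n(X)$, $\Omega_0(X)=\Omega(X)-1$. For a partition $\lambda$, $\ell(\lambda)$ is the number of parts, $\gcd(\lambda)$ the gcd of its parts, $z_\lambda=\prod_j m_j(\lambda)!\,j^{m_j(\lambda)}$ with $m_j(\lambda)$ the number of parts equal to $j$, and $\sigma_r(k)=\sum_{d\mid k}d^r$. For $n\ge1$, $H_n=\sum_{\lambda\vdash n}\frac{\sigma_{\ell(\lambda)-1}(\gcd(\lambda))}{z_\lambda}p_\lambda$. -}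

module Defs where

open import Data.Nat as ℕ using (ℕ; zero; suc; _∸_; _^_; _≤ᵇ_; _≡ᵇ_; _!)
open import Data.Nat.GCD using (gcd)
open import Data.Nat.Divisibility using (_∣?_)
open import Data.Nat.ListAction using (sum; product)
open import Data.Bool.ListAction using (and)
open import Data.List using (List; []; _∷_; [_]; _++_; length; map; foldr; applyUpTo; concatMap; filter)
open import Data.Bool using (Bool; true; false; if_then_else_; _∧_; not)
open import Data.Integer using (ℤ; +_)
open import Data.Rational using (ℚ; 0ℚ; 1ℚ; _/_; _+_; _*_)
open import Relation.Nullary using (does)

-- Formal power series in t and X = (x₁, x₂, …) over ℚ, given by their
-- coefficients:  A k β  is the coefficient of  t^k x₁^β₁ x₂^β₂ ⋯ x_m^β_m
-- (β lists the exponents of x₁, x₂, …; all further exponents are 0).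

Series : Set
Series = ℕ → List ℕ → ℚ

dvd : ℕ → ℕ → Bool
dvd d m = does (d ∣? m)

sumℚ : List ℚ → ℚ
sumℚ = foldr _+_ 0ℚ

-- a / d in ℚ (d is always ≥ 1 where used; d = 0 gives 0 by convention)
divℕ : ℤ → ℕ → ℚ
divℕ a zero    = 0ℚ
divℕ a (suc d) = a / suc d

ℕ→ℚ : ℕ → ℚ
ℕ→ℚ n = (+ n) / 1

-- h_n(X) = sum of all monomials of degree n: coefficient of x^β.
hCoeff : ℕ → List ℕ → ℚ
hCoeff n β = if sum β ≡ᵇ n then 1ℚ else 0ℚ

-- Ω₀(tX) = Σ_{n≥1} h_n(tX) = Σ_{n≥1} t^n h_n(X)
Ω₀tX : Series
Ω₀tX zero    β = 0ℚ
Ω₀tX (suc k) β = hCoeff (suc k) β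

-- p_n(A): replace every variable (t and all x_i) by its n-th power, n ≥ 1.
-- The monomial t^a x^α goes to t^(n a) x^(n α), so the coefficient of
-- t^k x^β in p_n(A) is that of t^(k/n) x^(β/n) in A if n divides k and
-- every β_i, and 0 otherwise.
pPleth : (n : ℕ) → .{{_ : ℕ.NonZero n}} → Series → Series
pPleth n A k β =
  if dvd n k ∧ and (map (dvd n) β)
  then A (k ℕ./ n) (map (ℕ._/ n) β)
  else 0ℚ

-- For the coefficient of t^k only n ≤ k can contribute: for k ≥ 1 we need
-- n ∣ k, and for k = 0 every term is a coefficient of t^0 in Ω₀(tX), i.e. 0.
-- So the (formally convergent) infinite sum is computed exactly by n = 1..k.
LHS : Series
LHS k β = sumℚ (applyUpTo (λ m → ((+ 1) / suc m) * pPleth (suc m) Ω₀tX k β) k)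

-- Partitions, as weakly decreasing lists of positive parts.

-- partsF fuel n b : partitions of n with all parts ≤ b (fuel ≥ n suffices)
partsF : ℕ → ℕ → ℕ → List (List ℕ)
partsF _        zero    b = [ [] ]
partsF zero     (suc n) b = []
partsF (suc f)  (suc n) b =
  concatMap (λ p → map (p ∷_) (partsF f (suc n ∸ p) p))
            (filter (λ p → p ℕ.≤? b) (applyUpTo suc (suc n)))

partitions : ℕ → List (List ℕ)
partitions n = partsF n n n

mult : ℕ → List ℕ → ℕ
mult j lam = length (filter (λ i → i ℕ.≟ j) lam)

-- z_λ = ∏_j m_j(λ)! j^{m_j(λ)}  (j ranges over 1..|λ|, which covers all parts)
zee : List ℕ → ℕ
zee lam = product (applyUpTo (λ i → (mult (suc i) lam) ! ℕ.* (suc i ^ mult (suc i) lam)) (sum lam))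

gcdList : List ℕ → ℕ
gcdList = foldr gcd 0

σ : ℕ → ℕ → ℕ
σ r k = sum (applyUpTo (λ i → if dvd (suc i) k then suc i ^ r else 0) k)

-- coefficient of x^β in the power sum p_λ = ∏_j p_{λ_j},  p_l = Σ_i x_i^l,
-- obtained by expanding the product: each factor p_{λ_j} chooses a variable.
-- choices l β: exponent vectors β' with x_i^l x^β' = x^β for some i.
choices : ℕ → List ℕ → List (List ℕ)
choices l []       = []
choices l (b ∷ bs) = (if l ≤ᵇ b then [ (b ∸ l) ∷ bs ] else [])
                     ++ map (b ∷_) (choices l bs)

pCoeff : List ℕ → List ℕ → ℕ
pCoeff []      β = if and (map (_≡ᵇ 0) β) then 1 else 0
pCoeff (l ∷ lam) β = sum (map (pCoeff lam) (choices l β))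

HCoeff : ℕ → List ℕ → ℚ
HCoeff n β = sumℚ (map (λ lam → divℕ (+ σ (length lam ∸ 1) (gcdList lam)) (zee lam)
                                 * ℕ→ℚ (pCoeff lam β))
                       (partitions n))

RHS : Series
RHS zero    β = 0ℚ
RHS (suc k) β = HCoeff (suc k) β

{-# OPTIONS --safe #-}

-- Writing σ_{ℓ-1}(gcd λ) = Σ_{d ∣ gcd λ} d^{ℓ-1} and exchanging sums, the coefficient of t^k in
-- Σ H_n t^n becomes Σ_{d ∣ k} Σ_{μ ⊢ k/d} d^{ℓ(μ)-1} p_{dμ} / z_{dμ}.  Since z_{dμ} = d^{ℓ(μ)} z_μ
-- and p_{dμ} = p_d[p_μ], the inner sum is (1/d) p_d[Σ_{μ ⊢ k/d} p_μ / z_μ] = (1/d) p_d[h_{k/d}],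
-- which is the coefficient of t^k in (1/d) p_d(Ω₀(tX)).
--
-- The classical identity h_m = Σ_{μ ⊢ m} p_μ / z_μ follows from Newton's identity
-- m h_m = Σ_i p_i h_{m-i}: the truncations Σ_{μ ⊢ m, parts ≤ b} p_μ / z_μ satisfy the same
-- recursion with i ≤ b, by induction on b, after grouping the c parts equal to b+1 of μ,
-- which contribute p_{b+1}^c / (c! (b+1)^c).

module Submission where

open import Defs
import Algebra.Properties.CommutativeSemigroup as CommutativeSemigroupProperties
open import Data.Bool using (Bool; true; false; T; _∧_; if_then_else_)
open import Data.Bool.Properties using (T-∧; ∧-commutativeMonoid)
open import Algebra.Bundles using (CommutativeMonoid)
open import Data.Bool.ListAction using (all)
open import Data.Empty using (⊥; ⊥-elim)
import Data.Integer as ℤ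
import Data.Integer.Properties as ℤₚ
import Data.Integer.Solver as ℤSolver
open import Data.List using (List; []; _∷_; [_]; _++_; map; length; applyUpTo; concatMap; filter; upTo; replicate)
import Data.List.Properties as Listₚ
open import Data.List.Relation.Unary.All as All using (All; []; _∷_)
open import Data.List.Relation.Unary.All.Properties using (++⁺; map⁺; all⁺; all⁻)
open import Data.Nat as ℕ using (ℕ; zero; suc; _∸_; _≤_; _<_; z≤n; s≤s; _≤ᵇ_; _≡ᵇ_; _<ᵇ_; _^_; _!)
import Data.Nat.Solver as ℕSolver
import Data.Nat.DivMod as ℕ
open import Data.Nat.Divisibility
  using (_∣_; _∣?_; divides; _∣0; ∣-refl; ∣-trans; 0∣⇒≡0; ∣m∣n⇒∣m+n; ∣m+n∣m⇒∣n; ∣m∸n∣n⇒∣m; m∣m*n; ∣⇒≤)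
open import Data.Nat.GCD using (gcd; gcd[m,n]∣m; gcd[m,n]∣n; gcd-greatest)
open import Data.Nat.ListAction using (sum; product)
import Data.Nat.Properties as ℕₚ
open import Data.Nat.Induction using (<-rec)
open import Data.Rational using (ℚ; 0ℚ; 1ℚ; _+_; _*_; fromℚᵘ)
open import Data.Rational.Properties
open import Data.Rational.Solver using (module +-*-Solver)
open import Data.Rational.Unnormalised as ℚᵘ using (mkℚᵘ; *≡*)
import Data.Rational.Unnormalised.Properties as ℚᵘₚ
open import Function.Bundles using (_⇔_; mk⇔; Equivalence)
open import Data.Product using (proj₁; proj₂)
open import Relation.Nullary using (does; yes; no)
open import Relation.Nullary.Decidable using (does-⇔)
open import Relation.Unary using (Pred; Decidable)
open import Relation.Binary.PropositionalEquality hiding ([_])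

private variable
  A A′ : Set

fromℚᵘ-+ : ∀ p q → fromℚᵘ (p ℚᵘ.+ q) ≡ fromℚᵘ p + fromℚᵘ q
fromℚᵘ-+ p q = toℚᵘ-injective (ℚᵘₚ.≃-trans (toℚᵘ-fromℚᵘ (p ℚᵘ.+ q))
  (ℚᵘₚ.≃-sym (ℚᵘₚ.≃-trans (toℚᵘ-homo-+ (fromℚᵘ p) (fromℚᵘ q))
    (ℚᵘₚ.+-cong (toℚᵘ-fromℚᵘ p) (toℚᵘ-fromℚᵘ q)))))

fromℚᵘ-* : ∀ p q → fromℚᵘ (p ℚᵘ.* q) ≡ fromℚᵘ p * fromℚᵘ q
fromℚᵘ-* p q = toℚᵘ-injective (ℚᵘₚ.≃-trans (toℚᵘ-fromℚᵘ (p ℚᵘ.* q))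
  (ℚᵘₚ.≃-sym (ℚᵘₚ.≃-trans (toℚᵘ-homo-* (fromℚᵘ p) (fromℚᵘ q))
    (ℚᵘₚ.*-cong (toℚᵘ-fromℚᵘ p) (toℚᵘ-fromℚᵘ q)))))

-- (ℤ.+ a) / suc d unfolds to fromℚᵘ (mkℚᵘ (ℤ.+ a) d), so identities between such fractions
-- reduce to integer identities between cross products.
fromℚᵘ-cross : ∀ p q → ℚᵘ.↥ p ℤ.* ℚᵘ.↧ q ≡ ℚᵘ.↥ q ℤ.* ℚᵘ.↧ p → fromℚᵘ p ≡ fromℚᵘ q
fromℚᵘ-cross p q cross = fromℚᵘ-cong {p} {q} (*≡* cross)

-- 1/n, with the junk value 1/0 = 0 inherited from divℕ.
recip : ℕ → ℚ
recip = divℕ (ℤ.+ 1)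

ℕ→ℚ-+ : ∀ m n → ℕ→ℚ (m ℕ.+ n) ≡ ℕ→ℚ m + ℕ→ℚ n
ℕ→ℚ-+ m n = trans (fromℚᵘ-cross (mkℚᵘ (ℤ.+ (m ℕ.+ n)) 0) (a ℚᵘ.+ b) (trans (cong (ℤ._* ℤ.+ 1) (ℤₚ.pos-+ m n))
    (solve 2 (λ x y → (x :+ y) :* con (ℤ.+ 1) := (x :* con (ℤ.+ 1) :+ y :* con (ℤ.+ 1)) :* con (ℤ.+ 1)) refl (ℤ.+ m) (ℤ.+ n))))
  (fromℚᵘ-+ a b)
  where
  open ℤSolver.+-*-Solver
  a = mkℚᵘ (ℤ.+ m) 0
  b = mkℚᵘ (ℤ.+ n) 0

ℕ→ℚ*recip : ∀ n .{{_ : ℕ.NonZero n}} → ℕ→ℚ n * recip n ≡ 1ℚ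
ℕ→ℚ*recip (suc n) = sym (trans (fromℚᵘ-cross (mkℚᵘ (ℤ.+ 1) 0) (a ℚᵘ.* b)
    (solve 1 (λ x → con (ℤ.+ 1) :* (con (ℤ.+ 1) :* x) := (x :* con (ℤ.+ 1)) :* con (ℤ.+ 1)) refl (ℤ.+ suc n)))
  (fromℚᵘ-* a b))
  where
  open ℤSolver.+-*-Solver
  a = mkℚᵘ (ℤ.+ suc n) 0
  b = mkℚᵘ (ℤ.+ 1) n

recip-* : ∀ m n → recip (m ℕ.* n) ≡ recip m * recip n
recip-* zero    n       = sym (*-zeroˡ (recip n))
recip-* (suc m) zero    = trans (cong recip (ℕₚ.*-zeroʳ m)) (sym (*-zeroʳ (recip (suc m))))
recip-* (suc m) (suc n) = trans (fromℚᵘ-cross (mkℚᵘ (ℤ.+ 1) (ℕ.pred (suc m ℕ.* suc n))) (a ℚᵘ.* b) (trans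
    (solve 2 (λ x y → con (ℤ.+ 1) :* (x :* y) := (con (ℤ.+ 1) :* con (ℤ.+ 1)) :* (x :* y)) refl (ℤ.+ suc m) (ℤ.+ suc n))
    (cong (ℤ.+ 1 ℤ.*_) (sym (ℤₚ.pos-* (suc m) (suc n))))))
  (fromℚᵘ-* a b)
  where
  open ℤSolver.+-*-Solver
  a = mkℚᵘ (ℤ.+ 1) m
  b = mkℚᵘ (ℤ.+ 1) n

divℕ≡ℕ→ℚ*recip : ∀ a d → divℕ (ℤ.+ a) d ≡ ℕ→ℚ a * recip d
divℕ≡ℕ→ℚ*recip a zero    = sym (*-zeroʳ (ℕ→ℚ a))
divℕ≡ℕ→ℚ*recip a (suc d) = trans (fromℚᵘ-cross (mkℚᵘ (ℤ.+ a) d) (p ℚᵘ.* q)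
    (solve 2 (λ x y → x :* (con (ℤ.+ 1) :* y) := (x :* con (ℤ.+ 1)) :* y) refl (ℤ.+ a) (ℤ.+ suc d)))
  (fromℚᵘ-* p q)
  where
  open ℤSolver.+-*-Solver
  p = mkℚᵘ (ℤ.+ a) 0
  q = mkℚᵘ (ℤ.+ 1) d

ℕ→ℚ-suc-cancelˡ : ∀ n x y → ℕ→ℚ (suc n) * x ≡ ℕ→ℚ (suc n) * y → x ≡ y
ℕ→ℚ-suc-cancelˡ n x y nx≡ny = begin
  x                        ≡⟨ sym (*-identityˡ x) ⟩
  1ℚ * x                   ≡⟨ cong (_* x) (sym inverse) ⟩
  recip k * ℕ→ℚ k * x      ≡⟨ *-assoc (recip k) (ℕ→ℚ k) x ⟩
  recip k * (ℕ→ℚ k * x)    ≡⟨ cong (recip k *_) nx≡ny ⟩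
  recip k * (ℕ→ℚ k * y)    ≡⟨ sym (*-assoc (recip k) (ℕ→ℚ k) y) ⟩
  recip k * ℕ→ℚ k * y      ≡⟨ cong (_* y) inverse ⟩
  1ℚ * y                   ≡⟨ *-identityˡ y ⟩
  y                        ∎
  where
  open ≡-Reasoning
  k = suc n
  inverse : recip k * ℕ→ℚ k ≡ 1ℚ
  inverse = trans (*-comm (recip k) (ℕ→ℚ k)) (ℕ→ℚ*recip k)

when : Bool → ℚ → ℚ
when b x = if b then x else 0ℚ

when-cong : ∀ b {x y} → (T b → x ≡ y) → when b x ≡ when b y
when-cong true  x≡y = x≡y _
when-cong false _   = refl

when-true : ∀ {b} x → T b → when b x ≡ x
when-true {true} x _ = refl

when-false : ∀ {b} x → (T b → ⊥) → when b x ≡ 0ℚ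
when-false {true}  x ¬b = ⊥-elim (¬b _)
when-false {false} x _  = refl

when-+ : ∀ b x y → when b (x + y) ≡ when b x + when b y
when-+ true  x y = refl
when-+ false x y = sym (+-identityˡ 0ℚ)

when-* : ∀ b x y → when b (x * y) ≡ x * when b y
when-* true  x y = refl
when-* false x y = sym (*-zeroʳ x)

when-∧ : ∀ a b x → when a (when b x) ≡ when (a ∧ b) x
when-∧ true  b x = refl
when-∧ false b x = refl

when-comm : ∀ a b x → when a (when b x) ≡ when b (when a x)
when-comm true  true  x = refl
when-comm true  false x = refl
when-comm false true  x = refl
when-comm false false x = refl

ℕ→ℚ-if : ∀ c x → ℕ→ℚ (if c then x else 0) ≡ when c (ℕ→ℚ x)
ℕ→ℚ-if true  x = refl
ℕ→ℚ-if false x = refl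

T-ext : ∀ {x y} → (T x → T y) → (T y → T x) → x ≡ y
T-ext {true}  {true}  _   _   = refl
T-ext {true}  {false} x⇒y _   = ⊥-elim (x⇒y _)
T-ext {false} {true}  _   y⇒x = ⊥-elim (y⇒x _)
T-ext {false} {false} _   _   = refl

≤ᵇ-suc : ∀ a x → (suc a ≤ᵇ suc x) ≡ (a ≤ᵇ x)
≤ᵇ-suc zero    x = refl
≤ᵇ-suc (suc a) x = refl

≤ᵇ-∧-∸ : ∀ a b x → ((a ≤ᵇ x) ∧ (b ≤ᵇ x ∸ a)) ≡ (a ℕ.+ b ≤ᵇ x)
≤ᵇ-∧-∸ zero    b x       = refl
≤ᵇ-∧-∸ (suc a) b zero    = refl
≤ᵇ-∧-∸ (suc a) b (suc x) = trans (cong (_∧ (b ≤ᵇ x ∸ a)) (≤ᵇ-suc a x))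
  (trans (≤ᵇ-∧-∸ a b x) (sym (≤ᵇ-suc (a ℕ.+ b) x)))

when-≤ᵇ-∸ : ∀ a b x y → when (a ≤ᵇ x) (when (b ≤ᵇ x ∸ a) y) ≡ when (a ℕ.+ b ≤ᵇ x) y
when-≤ᵇ-∸ a b x y = trans (when-∧ (a ≤ᵇ x) (b ≤ᵇ x ∸ a) y) (cong (λ c → when c y) (≤ᵇ-∧-∸ a b x))

when-≤-split : ∀ i b x → when (suc i ≤ᵇ suc b) x ≡ when (i ≡ᵇ b) x + when (suc i ≤ᵇ b) x
when-≤-split zero    zero    x = sym (+-identityʳ x)
when-≤-split zero    (suc b) x = sym (+-identityˡ x)
when-≤-split (suc i) zero    x = sym (+-identityˡ 0ℚ)
when-≤-split (suc i) (suc b) x = when-≤-split i b x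

≡ᵇ-+ˡ : ∀ r a b → (r ℕ.+ a ≡ᵇ r ℕ.+ b) ≡ (a ≡ᵇ b)
≡ᵇ-+ˡ zero    a b = refl
≡ᵇ-+ˡ (suc r) a b = ≡ᵇ-+ˡ r a b

≤ᵇ-∸-swap : ∀ a i m → suc i ≤ m → (suc i ≤ᵇ m ∸ a) ≡ (a ≤ᵇ m ∸ suc i)
≤ᵇ-∸-swap a i m i<m = does-⇔ (mk⇔ to from) (suc i ℕ.≤? m ∸ a) (a ℕ.≤? m ∸ suc i)
  where
  to : suc i ≤ m ∸ a → a ≤ m ∸ suc i
  to i<m∸a = ℕₚ.m+n≤o⇒m≤o∸n a (subst (_≤ m) (ℕₚ.+-comm (suc i) a) (ℕₚ.m≤o∸n⇒m+n≤o (suc i) a≤m i<m∸a))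
    where
    a≤m : a ≤ m
    a≤m = ℕₚ.<⇒≤ (ℕₚ.m∸n≢0⇒n<m (λ m∸a≡0 → ℕₚ.n≮0 (subst (suc i ≤_) m∸a≡0 i<m∸a)))
  from : a ≤ m ∸ suc i → suc i ≤ m ∸ a
  from a≤m∸i = ℕₚ.m+n≤o⇒m≤o∸n (suc i) (subst (_≤ m) (ℕₚ.+-comm a (suc i)) (ℕₚ.m≤o∸n⇒m+n≤o a i<m a≤m∸i))

-- Finite sums

∑ : List A → (A → ℚ) → ℚ
∑ L f = sumℚ (map f L)

∑< : ℕ → (ℕ → ℚ) → ℚ
∑< n f = sumℚ (applyUpTo f n)

syntax ∑ L (λ x → e) = ∑[ x ∈ L ] e
syntax ∑< n (λ i → e) = ∑[ i < n ] e

∑-cong : ∀ (L : List A) {f g : A → ℚ} → (∀ x → f x ≡ g x) → ∑ L f ≡ ∑ L g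
∑-cong []      f≗g = refl
∑-cong (x ∷ L) f≗g = cong₂ _+_ (f≗g x) (∑-cong L f≗g)

∑-congᴬ : ∀ {P : A → Set} (L : List A) {f g : A → ℚ} → All P L → (∀ {x} → P x → f x ≡ g x) → ∑ L f ≡ ∑ L g
∑-congᴬ []      []         f≗g = refl
∑-congᴬ (x ∷ L) (px ∷ pL) f≗g = cong₂ _+_ (f≗g px) (∑-congᴬ L pL f≗g)

∑-zero : ∀ (L : List A) → ∑ L (λ _ → 0ℚ) ≡ 0ℚ
∑-zero []      = refl
∑-zero (x ∷ L) = trans (+-identityˡ _) (∑-zero L)

∑-+ : ∀ (L : List A) (f g : A → ℚ) → ∑[ x ∈ L ] (f x + g x) ≡ ∑ L f + ∑ L g
∑-+ []      f g = sym (+-identityˡ 0ℚ)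
∑-+ (x ∷ L) f g = trans (cong ((f x + g x) +_) (∑-+ L f g))
  (solve 4 (λ a b c d → (a :+ b) :+ (c :+ d) := (a :+ c) :+ (b :+ d)) refl (f x) (g x) (∑ L f) (∑ L g))
  where open +-*-Solver

∑-*ˡ : ∀ (L : List A) c (f : A → ℚ) → ∑[ x ∈ L ] (c * f x) ≡ c * ∑ L f
∑-*ˡ []      c f = sym (*-zeroʳ c)
∑-*ˡ (x ∷ L) c f = trans (cong (c * f x +_) (∑-*ˡ L c f)) (sym (*-distribˡ-+ c (f x) _))

∑-when : ∀ (L : List A) b (f : A → ℚ) → ∑[ x ∈ L ] when b (f x) ≡ when b (∑ L f)
∑-when L true  f = refl
∑-when L false f = ∑-zero L

∑-++ : ∀ (xs ys : List A) (f : A → ℚ) → ∑ (xs ++ ys) f ≡ ∑ xs f + ∑ ys f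
∑-++ []       ys f = sym (+-identityˡ _)
∑-++ (x ∷ xs) ys f = trans (cong (f x +_) (∑-++ xs ys f)) (sym (+-assoc (f x) _ _))

∑-map : ∀ (L : List A) (g : A → A′) (f : A′ → ℚ) → ∑ (map g L) f ≡ ∑[ x ∈ L ] f (g x)
∑-map []      g f = refl
∑-map (x ∷ L) g f = cong (f (g x) +_) (∑-map L g f)

∑-concatMap : ∀ (L : List A) (g : A → List A′) (f : A′ → ℚ) → ∑ (concatMap g L) f ≡ ∑[ x ∈ L ] ∑ (g x) f
∑-concatMap []      g f = refl
∑-concatMap (x ∷ L) g f = trans (∑-++ (g x) (concatMap g L) f) (cong (∑ (g x) f +_) (∑-concatMap L g f))

∑-filter : ∀ {p} {P : Pred A p} (P? : Decidable P) (L : List A) (f : A → ℚ) →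
           ∑ (filter P? L) f ≡ ∑[ x ∈ L ] when (does (P? x)) (f x)
∑-filter P? []      f = refl
∑-filter P? (x ∷ L) f with does (P? x)
... | true  = cong (f x +_) (∑-filter P? L f)
... | false = trans (∑-filter P? L f) (sym (+-identityˡ _))

∑-comm : ∀ (L : List A) (M : List A′) (f : A → A′ → ℚ) → ∑[ x ∈ L ] ∑[ y ∈ M ] f x y ≡ ∑[ y ∈ M ] ∑[ x ∈ L ] f x y
∑-comm []      M f = sym (∑-zero M)
∑-comm (x ∷ L) M f = trans (cong (∑ M (f x) +_) (∑-comm L M f)) (sym (∑-+ M (f x) (λ y → ∑[ x ∈ L ] f x y)))

∑-applyUpTo : ∀ (g : ℕ → A) n (f : A → ℚ) → ∑ (applyUpTo g n) f ≡ ∑[ i < n ] f (g i)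
∑-applyUpTo g n f = cong sumℚ (Listₚ.map-applyUpTo g f n)

∑<≡∑upTo : ∀ n f → ∑< n f ≡ ∑ (upTo n) f
∑<≡∑upTo n f = sym (∑-applyUpTo (λ i → i) n f)

∑<-cong : ∀ n {f g : ℕ → ℚ} → (∀ i → i < n → f i ≡ g i) → ∑< n f ≡ ∑< n g
∑<-cong zero    f≗g = refl
∑<-cong (suc n) f≗g = cong₂ _+_ (f≗g 0 (s≤s z≤n)) (∑<-cong n (λ i i<n → f≗g (suc i) (s≤s i<n)))

∑<-zero : ∀ n → ∑< n (λ _ → 0ℚ) ≡ 0ℚ
∑<-zero n = trans (∑<≡∑upTo n _) (∑-zero (upTo n))

∑<-+ : ∀ n f g → ∑[ i < n ] (f i + g i) ≡ ∑< n f + ∑< n g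
∑<-+ n f g = trans (∑<≡∑upTo n _) (trans (∑-+ (upTo n) f g) (sym (cong₂ _+_ (∑<≡∑upTo n f) (∑<≡∑upTo n g))))

∑<-*ˡ : ∀ n c f → ∑[ i < n ] (c * f i) ≡ c * ∑< n f
∑<-*ˡ n c f = trans (∑<≡∑upTo n _) (trans (∑-*ˡ (upTo n) c f) (sym (cong (c *_) (∑<≡∑upTo n f))))

∑<-*ʳ : ∀ n c f → ∑[ i < n ] (f i * c) ≡ ∑< n f * c
∑<-*ʳ n c f = trans (∑<-cong n (λ i _ → *-comm (f i) c)) (trans (∑<-*ˡ n c f) (*-comm c _))

∑<-when : ∀ n b f → ∑[ i < n ] when b (f i) ≡ when b (∑< n f)
∑<-when n b f = trans (∑<≡∑upTo n _) (trans (∑-when (upTo n) b f) (cong (when b) (sym (∑<≡∑upTo n f))))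

∑<-snoc : ∀ n f → ∑< (suc n) f ≡ ∑< n f + f n
∑<-snoc zero    f = trans (+-identityʳ (f 0)) (sym (+-identityˡ (f 0)))
∑<-snoc (suc n) f = trans (cong (f 0 +_) (∑<-snoc n (λ i → f (suc i)))) (sym (+-assoc (f 0) _ _))

∑<-split : ∀ m n f → ∑< (m ℕ.+ n) f ≡ ∑< m f + ∑[ i < n ] f (m ℕ.+ i)
∑<-split zero    n f = sym (+-identityˡ _)
∑<-split (suc m) n f = trans (cong (f 0 +_) (∑<-split m n (λ i → f (suc i)))) (sym (+-assoc (f 0) _ _))

∑<-∑-comm : ∀ n (L : List A) (f : ℕ → A → ℚ) → ∑[ i < n ] ∑[ x ∈ L ] f i x ≡ ∑[ x ∈ L ] ∑[ i < n ] f i x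
∑<-∑-comm n L f = trans (∑<≡∑upTo n _) (trans (∑-comm (upTo n) L f) (∑-cong L (λ x → sym (∑<≡∑upTo n _))))

∑<-comm : ∀ m n (f : ℕ → ℕ → ℚ) → ∑[ i < m ] ∑[ j < n ] f i j ≡ ∑[ j < n ] ∑[ i < m ] f i j
∑<-comm m n f = trans (∑<-cong m (λ i _ → ∑<≡∑upTo n (f i))) (trans (∑<-∑-comm m (upTo n) f) (sym (∑<≡∑upTo n _)))

∑-const : ∀ (L : List A) c → ∑ L (λ _ → c) ≡ ℕ→ℚ (length L) * c
∑-const []      c = sym (*-zeroˡ c)
∑-const (x ∷ L) c = begin
  c + ∑ L (λ _ → c)              ≡⟨ cong (c +_) (∑-const L c) ⟩
  c + ℕ→ℚ (length L) * c         ≡⟨ cong (_+ ℕ→ℚ (length L) * c) (sym (*-identityˡ c)) ⟩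
  1ℚ * c + ℕ→ℚ (length L) * c    ≡⟨ sym (*-distribʳ-+ c 1ℚ (ℕ→ℚ (length L))) ⟩
  (1ℚ + ℕ→ℚ (length L)) * c      ≡⟨ cong (_* c) (sym (ℕ→ℚ-+ 1 (length L))) ⟩
  ℕ→ℚ (length (x ∷ L)) * c       ∎
  where open ≡-Reasoning

ℕ→ℚ-sum : ∀ (L : List A) (g : A → ℕ) → ℕ→ℚ (sum (map g L)) ≡ ∑[ x ∈ L ] ℕ→ℚ (g x)
ℕ→ℚ-sum []      g = refl
ℕ→ℚ-sum (x ∷ L) g = trans (ℕ→ℚ-+ (g x) _) (cong (ℕ→ℚ (g x) +_) (ℕ→ℚ-sum L g))

ℕ→ℚ-sum-applyUpTo : ∀ (f : ℕ → ℕ) n → ℕ→ℚ (sum (applyUpTo f n)) ≡ ∑[ i < n ] ℕ→ℚ (f i)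
ℕ→ℚ-sum-applyUpTo f zero    = refl
ℕ→ℚ-sum-applyUpTo f (suc n) = trans (ℕ→ℚ-+ (f 0) _) (cong (ℕ→ℚ (f 0) +_) (ℕ→ℚ-sum-applyUpTo (λ i → f (suc i)) n))

∑<-when-≡ : ∀ n j f → ∑[ i < n ] when (i ≡ᵇ j) (f i) ≡ when (j <ᵇ n) (f j)
∑<-when-≡ zero    j       f = refl
∑<-when-≡ (suc n) zero    f = trans (cong (f 0 +_) (∑<-zero n)) (+-identityʳ (f 0))
∑<-when-≡ (suc n) (suc j) f = trans (+-identityˡ _) (∑<-when-≡ n j (λ i → f (suc i)))

∑<-when-< : ∀ n d f → d ≤ n → ∑[ i < n ] when (suc i ≤ᵇ d) (f i) ≡ ∑< d f
∑<-when-< n       zero    f _         = ∑<-zero n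
∑<-when-< (suc n) (suc d) f (s≤s d≤n) = cong (f 0 +_) (∑<-when-< n d (λ i → f (suc i)) d≤n)

when-∑<-∸ : ∀ a m F → when (a ≤ᵇ m) (∑< (m ∸ a) F) ≡ ∑< (m ∸ a) F
when-∑<-∸ a m F with a ≤ᵇ m in a≤m
... | true  = refl
... | false = cong (λ k → ∑< k F) (sym (ℕₚ.m≤n⇒m∸n≡0 {m} {a}
                (ℕₚ.<⇒≤ (ℕₚ.≰⇒> {a} {m} (λ a≤m′ → subst T a≤m (ℕₚ.≤⇒≤ᵇ a≤m′))))))

∑<-count-≤ : ∀ m x → x ≤ m → ∑[ i < m ] when (suc i ≤ᵇ x) 1ℚ ≡ ℕ→ℚ x
∑<-count-≤ zero    zero    z≤n       = refl
∑<-count-≤ (suc m) zero    _         = ∑<-zero (suc m)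
∑<-count-≤ (suc m) (suc x) (s≤s x≤m) = trans
  (cong (1ℚ +_) (trans (∑<-cong m (λ i _ → cong (λ c → when c 1ℚ) (≤ᵇ-suc (suc i) x))) (∑<-count-≤ m x x≤m)))
  (sym (ℕ→ℚ-+ 1 x))

-- Sums over partitions

record IsPartition (m b : ℕ) (ρ : List ℕ) : Set where
  field
    sum≡    : sum ρ ≡ m
    parts≥1 : All (1 ≤_) ρ
    parts≤  : All (_≤ b) ρ

∑Part : ℕ → ℕ → (List ℕ → ℚ) → ℚ
∑Part m b w = ∑ (partsF m m b) w

∑-partsF-zero : ∀ f b w → ∑ (partsF f 0 b) w ≡ w []
∑-partsF-zero zero    b w = +-identityʳ _
∑-partsF-zero (suc f) b w = +-identityʳ _

∑-partsF-suc : ∀ f n b w → ∑ (partsF (suc f) (suc n) b) w ≡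
  ∑[ i < suc n ] when (suc i ≤ᵇ b) (∑[ ρ ∈ partsF f (n ∸ i) (suc i) ] w (suc i ∷ ρ))
∑-partsF-suc f n b w = begin
  ∑ (concatMap (λ p → map (p ∷_) (partsF f (suc n ∸ p) p)) firstParts) w
    ≡⟨ ∑-concatMap firstParts (λ p → map (p ∷_) (partsF f (suc n ∸ p) p)) w ⟩
  ∑[ p ∈ firstParts ] ∑ (map (p ∷_) (partsF f (suc n ∸ p) p)) w
    ≡⟨ ∑-filter (λ p → p ℕ.≤? b) (applyUpTo suc (suc n)) _ ⟩
  ∑[ p ∈ applyUpTo suc (suc n) ] when (p ≤ᵇ b) (∑ (map (p ∷_) (partsF f (suc n ∸ p) p)) w)
    ≡⟨ ∑-applyUpTo suc (suc n) (λ p → when (p ≤ᵇ b) (∑ (map (p ∷_) (partsF f (suc n ∸ p) p)) w)) ⟩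
  ∑[ i < suc n ] when (suc i ≤ᵇ b) (∑ (map (suc i ∷_) (partsF f (n ∸ i) (suc i))) w)
    ≡⟨ ∑<-cong (suc n) (λ i _ → cong (when (suc i ≤ᵇ b)) (∑-map (partsF f (n ∸ i) (suc i)) (suc i ∷_) w)) ⟩
  ∑[ i < suc n ] when (suc i ≤ᵇ b) (∑[ ρ ∈ partsF f (n ∸ i) (suc i) ] w (suc i ∷ ρ)) ∎
  where
  open ≡-Reasoning
  firstParts : List ℕ
  firstParts = filter (λ p → p ℕ.≤? b) (applyUpTo suc (suc n))

∑-partsF-fuel : ∀ f g m b w → m ≤ f → m ≤ g → ∑ (partsF f m b) w ≡ ∑ (partsF g m b) w
∑-partsF-fuel f g zero b w _ _ = trans (∑-partsF-zero f b w) (sym (∑-partsF-zero g b w))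
∑-partsF-fuel (suc f) (suc g) (suc n) b w (s≤s n≤f) (s≤s n≤g) =
  trans (∑-partsF-suc f n b w) (trans
    (∑<-cong (suc n) (λ i _ → cong (when (suc i ≤ᵇ b))
      (∑-partsF-fuel f g (n ∸ i) (suc i) (λ ρ → w (suc i ∷ ρ))
        (ℕₚ.≤-trans (ℕₚ.m∸n≤m n i) n≤f) (ℕₚ.≤-trans (ℕₚ.m∸n≤m n i) n≤g))))
    (sym (∑-partsF-suc g n b w)))

∑Part-zero : ∀ b w → ∑Part 0 b w ≡ w []
∑Part-zero = ∑-partsF-zero 0

∑Part-suc : ∀ n b w → ∑Part (suc n) b w ≡
  ∑[ i < suc n ] when (suc i ≤ᵇ b) (∑Part (n ∸ i) (suc i) (λ ρ → w (suc i ∷ ρ)))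
∑Part-suc n b w = trans (∑-partsF-suc n n b w) (∑<-cong (suc n) (λ i _ → cong (when (suc i ≤ᵇ b))
  (∑-partsF-fuel n (n ∸ i) (n ∸ i) (suc i) (λ ρ → w (suc i ∷ ρ)) (ℕₚ.m∸n≤m n i) ℕₚ.≤-refl)))

∑-partsF-cong : ∀ f m b {w w′ : List ℕ → ℚ} → (∀ ρ → IsPartition m b ρ → w ρ ≡ w′ ρ) →
                ∑ (partsF f m b) w ≡ ∑ (partsF f m b) w′
∑-partsF-cong f       zero    b w≗w′ = cong (_+ 0ℚ) (w≗w′ [] (record { sum≡ = refl ; parts≥1 = [] ; parts≤ = [] }))
∑-partsF-cong zero    (suc m) b w≗w′ = refl
∑-partsF-cong (suc f) (suc n) b {w} {w′} w≗w′ = trans (∑-partsF-suc f n b w) (trans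
  (∑<-cong (suc n) (λ i i<1+n → when-cong (suc i ≤ᵇ b) (λ i<b →
    ∑-partsF-cong f (n ∸ i) (suc i) (λ ρ ρ⊢ → w≗w′ (suc i ∷ ρ) (extend i<1+n (ℕₚ.≤ᵇ⇒≤ (suc i) b i<b) ρ⊢)))))
  (sym (∑-partsF-suc f n b w′)))
  where
  extend : ∀ {i ρ} → i < suc n → suc i ≤ b → IsPartition (n ∸ i) (suc i) ρ → IsPartition (suc n) b (suc i ∷ ρ)
  extend {i} i<1+n i<b ρ⊢ = record
    { sum≡    = cong suc (trans (cong (i ℕ.+_) (IsPartition.sum≡ ρ⊢)) (ℕₚ.m+[n∸m]≡n (ℕₚ.≤-pred i<1+n)))
    ; parts≥1 = s≤s z≤n ∷ IsPartition.parts≥1 ρ⊢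
    ; parts≤  = i<b ∷ All.map (λ p≤i → ℕₚ.≤-trans p≤i i<b) (IsPartition.parts≤ ρ⊢) }

∑Part-cong : ∀ m b {w w′ : List ℕ → ℚ} → (∀ ρ → IsPartition m b ρ → w ρ ≡ w′ ρ) → ∑Part m b w ≡ ∑Part m b w′
∑Part-cong m = ∑-partsF-cong m m

∑Part-largest : ∀ n b w → ∑Part (suc n) (suc b) w ≡
  when (suc b ≤ᵇ suc n) (∑Part (n ∸ b) (suc b) (λ ρ → w (suc b ∷ ρ))) + ∑Part (suc n) b w
∑Part-largest n b w = begin
  ∑Part (suc n) (suc b) w
    ≡⟨ ∑Part-suc n (suc b) w ⟩
  ∑[ i < suc n ] when (suc i ≤ᵇ suc b) (rest i)
    ≡⟨ ∑<-cong (suc n) (λ i _ → when-≤-split i b (rest i)) ⟩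
  ∑[ i < suc n ] (when (i ≡ᵇ b) (rest i) + when (suc i ≤ᵇ b) (rest i))
    ≡⟨ ∑<-+ (suc n) (λ i → when (i ≡ᵇ b) (rest i)) (λ i → when (suc i ≤ᵇ b) (rest i)) ⟩
  ∑[ i < suc n ] when (i ≡ᵇ b) (rest i) + ∑[ i < suc n ] when (suc i ≤ᵇ b) (rest i)
    ≡⟨ cong₂ _+_ (∑<-when-≡ (suc n) b rest) (sym (∑Part-suc n b w)) ⟩
  when (suc b ≤ᵇ suc n) (rest b) + ∑Part (suc n) b w ∎
  where
  open ≡-Reasoning
  rest : ℕ → ℚ
  rest i = ∑Part (n ∸ i) (suc i) (λ ρ → w (suc i ∷ ρ))

∑Part-blocks : ∀ b K m w → m ≤ K → ∑Part m (suc b) w ≡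
  ∑[ c < suc K ] when (c ℕ.* suc b ≤ᵇ m) (∑Part (m ∸ c ℕ.* suc b) b (λ ρ → w (replicate c (suc b) ++ ρ)))
∑Part-blocks b K zero w _ = sym (trans (cong (w [] + 0ℚ +_) (∑<-zero K)) (+-identityʳ (w [] + 0ℚ)))
∑Part-blocks b (suc K) (suc n) w (s≤s n≤K) = begin
  ∑Part (suc n) (suc b) w
    ≡⟨ ∑Part-largest n b w ⟩
  when (B ≤ᵇ suc n) (∑Part (n ∸ b) B w₁) + ∑Part (suc n) b w
    ≡⟨ cong (λ x → when (B ≤ᵇ suc n) x + ∑Part (suc n) b w)
            (∑Part-blocks b K (n ∸ b) w₁ (ℕₚ.≤-trans (ℕₚ.m∸n≤m n b) n≤K)) ⟩
  when (B ≤ᵇ suc n) (∑< (suc K) inner) + ∑Part (suc n) b w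
    ≡⟨ cong (_+ ∑Part (suc n) b w) (trans (sym (∑<-when (suc K) (B ≤ᵇ suc n) inner)) (∑<-cong (suc K) (λ c _ →
         trans (when-≤ᵇ-∸ B (c ℕ.* B) (suc n) _)
               (cong (λ m → when (suc c ℕ.* B ≤ᵇ suc n) (∑Part m b (λ ρ → w₁ (replicate c B ++ ρ))))
                     (ℕₚ.∸-+-assoc n b (c ℕ.* B)))))) ⟩
  ∑[ c < suc K ] block (suc c) + block 0
    ≡⟨ +-comm (∑[ c < suc K ] block (suc c)) (block 0) ⟩
  ∑[ c < suc (suc K) ] block c ∎
  where
  open ≡-Reasoning
  B = suc b
  w₁ : List ℕ → ℚ
  w₁ ρ = w (B ∷ ρ)
  inner : ℕ → ℚ
  inner c = when (c ℕ.* B ≤ᵇ n ∸ b) (∑Part (n ∸ b ∸ c ℕ.* B) b (λ ρ → w₁ (replicate c B ++ ρ)))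
  block : ℕ → ℚ
  block c = when (c ℕ.* B ≤ᵇ suc n) (∑Part (suc n ∸ c ℕ.* B) b (λ ρ → w (replicate c B ++ ρ)))

-- The numbers z_λ

mult-here : ∀ j ρ → mult j (j ∷ ρ) ≡ suc (mult j ρ)
mult-here j ρ = cong length (Listₚ.filter-accept (λ i → i ℕ.≟ j) {j} {ρ} refl)

mult-there : ∀ j x ρ → x ≢ j → mult j (x ∷ ρ) ≡ mult j ρ
mult-there j x ρ x≢j = cong length (Listₚ.filter-reject (λ i → i ℕ.≟ j) {x} {ρ} x≢j)

mult-above : ∀ b ρ → All (_≤ b) ρ → mult (suc b) ρ ≡ 0
mult-above b []      []            = refl
mult-above b (x ∷ ρ) (x≤b ∷ ρ≤b) = trans (mult-there (suc b) x ρ (λ x≡1+b → ℕₚ.<-irrefl x≡1+b (s≤s x≤b)))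
                                           (mult-above b ρ ρ≤b)

mult-> : ∀ j ρ → sum ρ < j → mult j ρ ≡ 0
mult-> j []      _ = refl
mult-> j (x ∷ ρ) ρ<j = trans (mult-there j x ρ (λ x≡j → ℕₚ.<-irrefl x≡j (ℕₚ.≤-<-trans (ℕₚ.m≤m+n x (sum ρ)) ρ<j)))
  (mult-> j ρ (ℕₚ.≤-<-trans (ℕₚ.m≤n+m (sum ρ) x) ρ<j))

zFactor : ℕ → List ℕ → ℕ
zFactor j lam = mult j lam ! ℕ.* j ^ mult j lam

applyUpTo-cong : ∀ {f g : ℕ → A} n → (∀ i → f i ≡ g i) → applyUpTo f n ≡ applyUpTo g n
applyUpTo-cong zero    f≗g = refl
applyUpTo-cong (suc n) f≗g = cong₂ _∷_ (f≗g 0) (applyUpTo-cong n (λ i → f≗g (suc i)))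

product-applyUpTo-ones : ∀ m n (f : ℕ → ℕ) → m ≤ n → (∀ i → m ≤ i → f i ≡ 1) →
                         product (applyUpTo f n) ≡ product (applyUpTo f m)
product-applyUpTo-ones zero    zero    f _         _    = refl
product-applyUpTo-ones zero    (suc n) f _         f≡1 =
  trans (cong₂ ℕ._*_ (f≡1 0 z≤n) (product-applyUpTo-ones 0 n (λ i → f (suc i)) z≤n (λ i _ → f≡1 (suc i) z≤n)))
        (ℕₚ.*-identityʳ 1)
product-applyUpTo-ones (suc m) (suc n) f (s≤s m≤n) f≡1 =
  cong (f 0 ℕ.*_) (product-applyUpTo-ones m n (λ i → f (suc i)) m≤n (λ i m≤i → f≡1 (suc i) (s≤s m≤i)))

product-applyUpTo-scaleAt : ∀ n k (f g : ℕ → ℕ) c → k < n → f k ≡ c ℕ.* g k → (∀ i → i ≢ k → f i ≡ g i) →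
                            product (applyUpTo f n) ≡ c ℕ.* product (applyUpTo g n)
product-applyUpTo-scaleAt (suc n) zero f g c _ fk≡cgk f≗g =
  trans (cong₂ ℕ._*_ fk≡cgk (cong product (applyUpTo-cong n (λ i → f≗g (suc i) (λ ())))))
        (ℕₚ.*-assoc c (g 0) _)
product-applyUpTo-scaleAt (suc n) (suc k) f g c (s≤s k<n) fk≡cgk f≗g = trans
  (cong₂ ℕ._*_ (f≗g 0 (λ ()))
    (product-applyUpTo-scaleAt n k (λ i → f (suc i)) (λ i → g (suc i)) c k<n fk≡cgk
      (λ i i≢k → f≗g (suc i) (λ 1+i≡1+k → i≢k (ℕₚ.suc-injective 1+i≡1+k)))))
  (solve 3 (λ a b c → a :* (b :* c) := b :* (a :* c)) refl (g 0) c _)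
  where open ℕSolver.+-*-Solver

zee-range : ∀ lam n → sum lam ≤ n → product (applyUpTo (λ i → zFactor (suc i) lam) n) ≡ zee lam
zee-range lam n lam≤n = product-applyUpTo-ones (sum lam) n (λ i → zFactor (suc i) lam) lam≤n
  (λ i lam≤i → cong (λ m → m ! ℕ.* suc i ^ m) (mult-> (suc i) lam (s≤s lam≤i)))

zee-cons : ∀ k ρ → zee (suc k ∷ ρ) ≡ suc k ℕ.* suc (mult (suc k) ρ) ℕ.* zee ρ
zee-cons k ρ = trans
  (product-applyUpTo-scaleAt (suc k ℕ.+ sum ρ) k (λ i → zFactor (suc i) (suc k ∷ ρ)) (λ i → zFactor (suc i) ρ) c
    (s≤s (ℕₚ.m≤m+n k (sum ρ))) factor-k factor-other)
  (cong (c ℕ.*_) (zee-range ρ (suc k ℕ.+ sum ρ) (ℕₚ.m≤n+m (sum ρ) (suc k))))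
  where
  open ℕSolver.+-*-Solver
  m = mult (suc k) ρ
  c = suc k ℕ.* suc m
  factor-k : zFactor (suc k) (suc k ∷ ρ) ≡ c ℕ.* zFactor (suc k) ρ
  factor-k = trans (cong (λ t → t ! ℕ.* suc k ^ t) (mult-here (suc k) ρ))
    (solve 4 (λ p s f q → (s :* f) :* (p :* q) := p :* s :* (f :* q)) refl (suc k) (suc m) (m !) (suc k ^ m))
  factor-other : ∀ i → i ≢ k → zFactor (suc i) (suc k ∷ ρ) ≡ zFactor (suc i) ρ
  factor-other i i≢k = cong (λ t → t ! ℕ.* suc i ^ t) (mult-there (suc i) (suc k) ρ (λ k≡i → i≢k (sym (ℕₚ.suc-injective k≡i))))

zee-replicate : ∀ c k ρ → mult (suc k) ρ ≡ 0 → zee (replicate c (suc k) ++ ρ) ≡ c ! ℕ.* suc k ^ c ℕ.* zee ρ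
zee-replicate zero    k ρ _        = sym (ℕₚ.+-identityʳ (zee ρ))
zee-replicate (suc c) k ρ k∉ρ = begin
  zee (suc k ∷ replicate c (suc k) ++ ρ)
    ≡⟨ zee-cons k (replicate c (suc k) ++ ρ) ⟩
  suc k ℕ.* suc (mult (suc k) (replicate c (suc k) ++ ρ)) ℕ.* zee (replicate c (suc k) ++ ρ)
    ≡⟨ cong₂ (λ u v → suc k ℕ.* suc u ℕ.* v) (mult-replicate c) (zee-replicate c k ρ k∉ρ) ⟩
  suc k ℕ.* suc c ℕ.* (c ! ℕ.* suc k ^ c ℕ.* zee ρ)
    ≡⟨ solve 5 (λ p s f q z → p :* s :* (f :* q :* z) := (s :* f) :* (p :* q) :* z) refl (suc k) (suc c) (c !) (suc k ^ c) (zee ρ) ⟩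
  suc c ! ℕ.* suc k ^ suc c ℕ.* zee ρ ∎
  where
  open ≡-Reasoning
  open ℕSolver.+-*-Solver
  mult-replicate : ∀ c → mult (suc k) (replicate c (suc k) ++ ρ) ≡ c
  mult-replicate zero    = k∉ρ
  mult-replicate (suc c) = trans (mult-here (suc k) (replicate c (suc k) ++ ρ)) (cong suc (mult-replicate c))

mult-scale : ∀ n j ρ → mult (suc n ℕ.* j) (map (suc n ℕ.*_) ρ) ≡ mult j ρ
mult-scale n j []      = refl
mult-scale n j (x ∷ ρ) with x ℕ.≟ j
... | yes refl = trans (mult-here (suc n ℕ.* x) (map (suc n ℕ.*_) ρ))
                       (trans (cong suc (mult-scale n x ρ)) (sym (mult-here x ρ)))
... | no x≢j   = trans (mult-there (suc n ℕ.* j) (suc n ℕ.* x) _ (λ nx≡nj → x≢j (ℕₚ.*-cancelˡ-≡ x j (suc n) nx≡nj)))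
                       (trans (mult-scale n j ρ) (sym (mult-there j x ρ x≢j)))

zee-scale : ∀ n μ → All (1 ≤_) μ → zee (map (suc n ℕ.*_) μ) ≡ suc n ^ length μ ℕ.* zee μ
zee-scale n []          []            = refl
zee-scale n (suc p ∷ μ) (_ ∷ μ≥1) = begin
  zee (suc n ℕ.* suc p ∷ map (suc n ℕ.*_) μ)
    ≡⟨ zee-cons (p ℕ.+ n ℕ.* suc p) (map (suc n ℕ.*_) μ) ⟩
  suc n ℕ.* suc p ℕ.* suc (mult (suc n ℕ.* suc p) (map (suc n ℕ.*_) μ)) ℕ.* zee (map (suc n ℕ.*_) μ)
    ≡⟨ cong₂ (λ u v → suc n ℕ.* suc p ℕ.* suc u ℕ.* v) (mult-scale n (suc p) μ) (zee-scale n μ μ≥1) ⟩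
  suc n ℕ.* suc p ℕ.* suc (mult (suc p) μ) ℕ.* (suc n ^ length μ ℕ.* zee μ)
    ≡⟨ solve 5 (λ a b c d e → a :* b :* c :* (d :* e) := (a :* d) :* (b :* c :* e)) refl
         (suc n) (suc p) (suc (mult (suc p) μ)) (suc n ^ length μ) (zee μ) ⟩
  suc n ^ length (suc p ∷ μ) ℕ.* (suc p ℕ.* suc (mult (suc p) μ) ℕ.* zee μ)
    ≡⟨ cong (suc n ^ length (suc p ∷ μ) ℕ.*_) (sym (zee-cons p μ)) ⟩
  suc n ^ length (suc p ∷ μ) ℕ.* zee (suc p ∷ μ) ∎
  where
  open ≡-Reasoning
  open ℕSolver.+-*-Solver

Coeffs : Set
Coeffs = List ℕ → ℚ

-- The coefficient of x^β in p_l · G, for G given by its coefficients.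
pMul : ℕ → Coeffs → Coeffs
pMul l G β = ∑ (choices l β) G

pCoeffℚ : List ℕ → Coeffs
pCoeffℚ lam β = ℕ→ℚ (pCoeff lam β)

pCoeffℚ-cons : ∀ l lam β → pCoeffℚ (l ∷ lam) β ≡ pMul l (pCoeffℚ lam) β
pCoeffℚ-cons l lam β = ℕ→ℚ-sum (choices l β) (pCoeff lam)

pMul-cons : ∀ l G x xs → pMul l G (x ∷ xs) ≡ when (l ≤ᵇ x) (G ((x ∸ l) ∷ xs)) + pMul l (λ ys → G (x ∷ ys)) xs
pMul-cons l G x xs with l ≤ᵇ x
... | true  = cong (G ((x ∸ l) ∷ xs) +_) (∑-map (choices l xs) (x ∷_) G)
... | false = trans (∑-map (choices l xs) (x ∷_) G) (sym (+-identityˡ _))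

pMul-cong : ∀ l {F G : Coeffs} → (∀ β → F β ≡ G β) → ∀ β → pMul l F β ≡ pMul l G β
pMul-cong l F≗G β = ∑-cong (choices l β) F≗G

pMul-+ : ∀ l (F G : Coeffs) β → pMul l (λ γ → F γ + G γ) β ≡ pMul l F β + pMul l G β
pMul-+ l F G β = ∑-+ (choices l β) F G

pMul-*ˡ : ∀ l c (F : Coeffs) β → pMul l (λ γ → c * F γ) β ≡ c * pMul l F β
pMul-*ˡ l c F β = ∑-*ˡ (choices l β) c F

pMul-when : ∀ l b (F : Coeffs) β → pMul l (λ γ → when b (F γ)) β ≡ when b (pMul l F β)
pMul-when l b F β = ∑-when (choices l β) b F

pMul-∑ : ∀ l (L : List A) (F : A → Coeffs) β → pMul l (λ γ → ∑[ x ∈ L ] F x γ) β ≡ ∑[ x ∈ L ] pMul l (F x) β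
pMul-∑ l L F β = ∑-comm (choices l β) L (λ γ x → F x γ)

pMul-∑< : ∀ l n (F : ℕ → Coeffs) β → pMul l (λ γ → ∑[ i < n ] F i γ) β ≡ ∑[ i < n ] pMul l (F i) β
pMul-∑< l n F β = trans (pMul-cong l (λ γ → ∑<≡∑upTo n (λ i → F i γ)) β)
  (trans (pMul-∑ l (upTo n) F β) (sym (∑<≡∑upTo n _)))

pMul-pMul-cons : ∀ a b G x xs → pMul a (pMul b G) (x ∷ xs) ≡
    when (a ℕ.+ b ≤ᵇ x) (G ((x ∸ (a ℕ.+ b)) ∷ xs))
  + when (a ≤ᵇ x) (pMul b (λ ys → G ((x ∸ a) ∷ ys)) xs)
  + when (b ≤ᵇ x) (pMul a (λ ys → G ((x ∸ b) ∷ ys)) xs)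
  + pMul a (pMul b (λ ys → G (x ∷ ys))) xs
pMul-pMul-cons a b G x xs = begin
  pMul a (pMul b G) (x ∷ xs)
    ≡⟨ pMul-cons a (pMul b G) x xs ⟩
  when (a ≤ᵇ x) (pMul b G ((x ∸ a) ∷ xs)) + pMul a (λ ys → pMul b G (x ∷ ys)) xs
    ≡⟨ cong₂ _+_ (cong (when (a ≤ᵇ x)) (pMul-cons b G (x ∸ a) xs)) (pMul-cong a (λ ys → pMul-cons b G x ys) xs) ⟩
  when (a ≤ᵇ x) (when (b ≤ᵇ x ∸ a) (G ((x ∸ a ∸ b) ∷ xs)) + Pb)
    + pMul a (λ ys → when (b ≤ᵇ x) (G ((x ∸ b) ∷ ys)) + pMul b (λ zs → G (x ∷ zs)) ys) xs
    ≡⟨ cong₂ _+_ (when-+ (a ≤ᵇ x) _ Pb)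
         (trans (pMul-+ a (λ ys → when (b ≤ᵇ x) (G ((x ∸ b) ∷ ys))) (pMul b (λ ys → G (x ∷ ys))) xs)
                (cong (_+ Rest) (pMul-when a (b ≤ᵇ x) (λ ys → G ((x ∸ b) ∷ ys)) xs))) ⟩
  (when (a ≤ᵇ x) (when (b ≤ᵇ x ∸ a) (G ((x ∸ a ∸ b) ∷ xs))) + when (a ≤ᵇ x) Pb) + (when (b ≤ᵇ x) Pa + Rest)
    ≡⟨ cong (λ u → (u + when (a ≤ᵇ x) Pb) + (when (b ≤ᵇ x) Pa + Rest))
         (trans (when-≤ᵇ-∸ a b x _) (cong (λ t → when (a ℕ.+ b ≤ᵇ x) (G (t ∷ xs))) (ℕₚ.∸-+-assoc x a b))) ⟩
  (when (a ℕ.+ b ≤ᵇ x) (G ((x ∸ (a ℕ.+ b)) ∷ xs)) + when (a ≤ᵇ x) Pb) + (when (b ≤ᵇ x) Pa + Rest)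
    ≡⟨ sym (+-assoc (when (a ℕ.+ b ≤ᵇ x) (G ((x ∸ (a ℕ.+ b)) ∷ xs)) + when (a ≤ᵇ x) Pb) (when (b ≤ᵇ x) Pa) Rest) ⟩
  when (a ℕ.+ b ≤ᵇ x) (G ((x ∸ (a ℕ.+ b)) ∷ xs)) + when (a ≤ᵇ x) Pb + when (b ≤ᵇ x) Pa + Rest ∎
  where
  open ≡-Reasoning
  Pa = pMul a (λ ys → G ((x ∸ b) ∷ ys)) xs
  Pb = pMul b (λ ys → G ((x ∸ a) ∷ ys)) xs
  Rest = pMul a (pMul b (λ ys → G (x ∷ ys))) xs

pMul-comm : ∀ a b (G : Coeffs) β → pMul a (pMul b G) β ≡ pMul b (pMul a G) β
pMul-comm a b G []       = refl
pMul-comm a b G (x ∷ xs) = begin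
  pMul a (pMul b G) (x ∷ xs)
    ≡⟨ pMul-pMul-cons a b G x xs ⟩
  both a b + when (a ≤ᵇ x) Pb + when (b ≤ᵇ x) Pa + pMul a (pMul b (λ ys → G (x ∷ ys))) xs
    ≡⟨ solve 4 (λ p q r s → p :+ q :+ r :+ s := p :+ r :+ q :+ s) refl (both a b) (when (a ≤ᵇ x) Pb) (when (b ≤ᵇ x) Pa) _ ⟩
  both a b + when (b ≤ᵇ x) Pa + when (a ≤ᵇ x) Pb + pMul a (pMul b (λ ys → G (x ∷ ys))) xs
    ≡⟨ cong₂ (λ u v → u + when (b ≤ᵇ x) Pa + when (a ≤ᵇ x) Pb + v)
         (cong both′ (ℕₚ.+-comm a b)) (pMul-comm a b (λ ys → G (x ∷ ys)) xs) ⟩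
  both b a + when (b ≤ᵇ x) Pa + when (a ≤ᵇ x) Pb + pMul b (pMul a (λ ys → G (x ∷ ys))) xs
    ≡⟨ sym (pMul-pMul-cons b a G x xs) ⟩
  pMul b (pMul a G) (x ∷ xs) ∎
  where
  open ≡-Reasoning
  open +-*-Solver
  both′ : ℕ → ℚ
  both′ s = when (s ≤ᵇ x) (G ((x ∸ s) ∷ xs))
  both : ℕ → ℕ → ℚ
  both a b = both′ (a ℕ.+ b)
  Pa = pMul a (λ ys → G ((x ∸ b) ∷ ys)) xs
  Pb = pMul b (λ ys → G ((x ∸ a) ∷ ys)) xs

pMul^ : ℕ → ℕ → Coeffs → Coeffs
pMul^ zero    l G = G
pMul^ (suc c) l G = pMul l (pMul^ c l G)

pMul^-cong : ∀ c l {F G : Coeffs} → (∀ β → F β ≡ G β) → ∀ β → pMul^ c l F β ≡ pMul^ c l G β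
pMul^-cong zero    l F≗G β = F≗G β
pMul^-cong (suc c) l F≗G β = pMul-cong l (pMul^-cong c l F≗G) β

pMul-pMul^ : ∀ r c l (G : Coeffs) β → pMul r (pMul^ c l G) β ≡ pMul^ c l (pMul r G) β
pMul-pMul^ r zero    l G β = refl
pMul-pMul^ r (suc c) l G β = trans (pMul-comm r l (pMul^ c l G) β) (pMul-cong l (pMul-pMul^ r c l G) β)

pMul^-*ˡ : ∀ c l q (F : Coeffs) β → pMul^ c l (λ γ → q * F γ) β ≡ q * pMul^ c l F β
pMul^-*ˡ zero    l q F β = refl
pMul^-*ˡ (suc c) l q F β = trans (pMul-cong l (pMul^-*ˡ c l q F) β) (pMul-*ˡ l q (pMul^ c l F) β)

pMul^-when : ∀ c l b (F : Coeffs) β → pMul^ c l (λ γ → when b (F γ)) β ≡ when b (pMul^ c l F β)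
pMul^-when zero    l b F β = refl
pMul^-when (suc c) l b F β = trans (pMul-cong l (pMul^-when c l b F) β) (pMul-when l b (pMul^ c l F) β)

pMul^-∑ : ∀ c l (L : List A) (F : A → Coeffs) β → pMul^ c l (λ γ → ∑[ x ∈ L ] F x γ) β ≡ ∑[ x ∈ L ] pMul^ c l (F x) β
pMul^-∑ zero    l L F β = refl
pMul^-∑ (suc c) l L F β = trans (pMul-cong l (pMul^-∑ c l L F) β) (pMul-∑ l L (λ x → pMul^ c l (F x)) β)

pMul^-∑< : ∀ c l n (F : ℕ → Coeffs) β → pMul^ c l (λ γ → ∑[ i < n ] F i γ) β ≡ ∑[ i < n ] pMul^ c l (F i) β
pMul^-∑< zero    l n F β = refl
pMul^-∑< (suc c) l n F β = trans (pMul-cong l (pMul^-∑< c l n F) β) (pMul-∑< l n (λ i → pMul^ c l (F i)) β)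

pCoeffℚ-replicate : ∀ c l ρ β → pCoeffℚ (replicate c l ++ ρ) β ≡ pMul^ c l (pCoeffℚ ρ) β
pCoeffℚ-replicate zero    l ρ β = refl
pCoeffℚ-replicate (suc c) l ρ β = trans (pCoeffℚ-cons l (replicate c l ++ ρ) β) (pMul-cong l (pCoeffℚ-replicate c l ρ) β)

-- Newton's identity and h_m = Σ_{μ ⊢ m} p_μ / z_μ

choices-sum : ∀ r β → All (λ β′ → r ℕ.+ sum β′ ≡ sum β) (choices r β)
choices-sum r []       = []
choices-sum r (x ∷ xs) = ++⁺ first (map⁺ (All.map (λ {β′} r+β′≡xs →
    trans (+-leftComm r x (sum β′)) (cong (x ℕ.+_) r+β′≡xs)) (choices-sum r xs)))
  where
  open CommutativeSemigroupProperties ℕₚ.+-commutativeSemigroup using () renaming (x∙yz≈y∙xz to +-leftComm)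
  first : All (λ β′ → r ℕ.+ sum β′ ≡ sum (x ∷ xs)) (if r ≤ᵇ x then [ (x ∸ r) ∷ xs ] else [])
  first with r ≤ᵇ x in r≤x
  ... | true  = trans (sym (ℕₚ.+-assoc r (x ∸ r) (sum xs)))
                      (cong (ℕ._+ sum xs) (ℕₚ.m+[n∸m]≡n (ℕₚ.≤ᵇ⇒≤ r x (subst T (sym r≤x) _)))) ∷ []
  ... | false = []

pMul-hCoeff : ∀ r m β → r ≤ m → pMul r (hCoeff (m ∸ r)) β ≡ ℕ→ℚ (length (choices r β)) * hCoeff m β
pMul-hCoeff r m β r≤m =
  trans (∑-congᴬ (choices r β) (choices-sum r β) (λ {β′} → lowered {β′})) (∑-const (choices r β) (hCoeff m β))
  where
  lowered : ∀ {β′} → r ℕ.+ sum β′ ≡ sum β → hCoeff (m ∸ r) β′ ≡ hCoeff m β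
  lowered {β′} r+β′≡β = cong (λ c → if c then 1ℚ else 0ℚ)
    (trans (sym (≡ᵇ-+ˡ r (sum β′) (m ∸ r))) (cong₂ _≡ᵇ_ r+β′≡β (ℕₚ.m+[n∸m]≡n r≤m)))

length-choices-cons : ∀ r x xs → ℕ→ℚ (length (choices r (x ∷ xs))) ≡ when (r ≤ᵇ x) 1ℚ + ℕ→ℚ (length (choices r xs))
length-choices-cons r x xs with r ≤ᵇ x
... | true  = trans (cong (λ n → ℕ→ℚ (suc n)) (Listₚ.length-map (x ∷_) (choices r xs))) (ℕ→ℚ-+ 1 (length (choices r xs)))
... | false = trans (cong ℕ→ℚ (Listₚ.length-map (x ∷_) (choices r xs))) (sym (+-identityˡ _))

∑<-length-choices : ∀ β m → sum β ≤ m → ∑[ i < m ] ℕ→ℚ (length (choices (suc i) β)) ≡ ℕ→ℚ (sum β)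
∑<-length-choices []       m _ = ∑<-zero m
∑<-length-choices (x ∷ xs) m x+xs≤m = begin
  ∑[ i < m ] ℕ→ℚ (length (choices (suc i) (x ∷ xs)))
    ≡⟨ ∑<-cong m (λ i _ → length-choices-cons (suc i) x xs) ⟩
  ∑[ i < m ] (when (suc i ≤ᵇ x) 1ℚ + ℕ→ℚ (length (choices (suc i) xs)))
    ≡⟨ ∑<-+ m (λ i → when (suc i ≤ᵇ x) 1ℚ) (λ i → ℕ→ℚ (length (choices (suc i) xs))) ⟩
  ∑[ i < m ] when (suc i ≤ᵇ x) 1ℚ + ∑[ i < m ] ℕ→ℚ (length (choices (suc i) xs))
    ≡⟨ cong₂ _+_ (∑<-count-≤ m x (ℕₚ.≤-trans (ℕₚ.m≤m+n x (sum xs)) x+xs≤m))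
                 (∑<-length-choices xs m (ℕₚ.≤-trans (ℕₚ.m≤n+m (sum xs) x) x+xs≤m)) ⟩
  ℕ→ℚ x + ℕ→ℚ (sum xs)
    ≡⟨ sym (ℕ→ℚ-+ x (sum xs)) ⟩
  ℕ→ℚ (sum (x ∷ xs)) ∎
  where open ≡-Reasoning

-- Summed over i, the ways of lowering one exponent of β by i count each exponent β_j exactly
-- β_j times, hence |β| = m times in all.
hCoeff-newton : ∀ m β → ∑[ i < m ] pMul (suc i) (hCoeff (m ∸ suc i)) β ≡ ℕ→ℚ m * hCoeff m β
hCoeff-newton m β = begin
  ∑[ i < m ] pMul (suc i) (hCoeff (m ∸ suc i)) β
    ≡⟨ ∑<-cong m (λ i i<m → pMul-hCoeff (suc i) m β i<m) ⟩
  ∑[ i < m ] (ℕ→ℚ (length (choices (suc i) β)) * hCoeff m β)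
    ≡⟨ ∑<-*ʳ m (hCoeff m β) (λ i → ℕ→ℚ (length (choices (suc i) β))) ⟩
  ∑[ i < m ] ℕ→ℚ (length (choices (suc i) β)) * hCoeff m β
    ≡⟨ degree-m ⟩
  ℕ→ℚ m * hCoeff m β ∎
  where
  open ≡-Reasoning
  degree-m : ∑[ i < m ] ℕ→ℚ (length (choices (suc i) β)) * hCoeff m β ≡ ℕ→ℚ m * hCoeff m β
  degree-m with sum β ≡ᵇ m in β≡m
  ... | true  = cong (_* 1ℚ) (trans (∑<-length-choices β m (ℕₚ.≤-reflexive β≡m′)) (cong ℕ→ℚ β≡m′))
    where β≡m′ = ℕₚ.≡ᵇ⇒≡ (sum β) m (subst T (sym β≡m) _)
  ... | false = trans (*-zeroʳ (∑[ i < m ] ℕ→ℚ (length (choices (suc i) β)))) (sym (*-zeroʳ (ℕ→ℚ m)))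

cycleIndex : ℕ → ℕ → Coeffs
cycleIndex b m γ = ∑Part m b (λ μ → recip (zee μ) * pCoeffℚ μ γ)

-- The factor of 1 / z_μ contributed by c parts equal to l.
blockWeight : ℕ → ℕ → ℚ
blockWeight l c = recip (c ! ℕ.* l ^ c)

cycleIndex-blocks : ∀ b m K γ → m ≤ K → cycleIndex (suc b) m γ ≡
  ∑[ c < suc K ] when (c ℕ.* suc b ≤ᵇ m) (blockWeight (suc b) c * pMul^ c (suc b) (cycleIndex b (m ∸ c ℕ.* suc b)) γ)
cycleIndex-blocks b m K γ m≤K = trans (∑Part-blocks b K m (λ μ → recip (zee μ) * pCoeffℚ μ γ) m≤K)
  (∑<-cong (suc K) (λ c _ → cong (when (c ℕ.* suc b ≤ᵇ m)) (blocks c)))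
  where
  blocks : ∀ c → ∑Part (m ∸ c ℕ.* suc b) b (λ ρ → recip (zee (replicate c (suc b) ++ ρ)) * pCoeffℚ (replicate c (suc b) ++ ρ) γ)
               ≡ blockWeight (suc b) c * pMul^ c (suc b) (cycleIndex b (m ∸ c ℕ.* suc b)) γ
  blocks c = begin
    ∑Part m′ b (λ ρ → recip (zee (replicate c (suc b) ++ ρ)) * pCoeffℚ (replicate c (suc b) ++ ρ) γ)
      ≡⟨ ∑Part-cong m′ b (λ ρ ρ⊢ → cong₂ _*_
           (trans (cong recip (zee-replicate c b ρ (mult-above b ρ (IsPartition.parts≤ ρ⊢))))
                  (recip-* (c ! ℕ.* suc b ^ c) (zee ρ)))
           (pCoeffℚ-replicate c (suc b) ρ γ)) ⟩
    ∑[ ρ ∈ partsF m′ m′ b ] (blockWeight (suc b) c * recip (zee ρ) * pMul^ c (suc b) (pCoeffℚ ρ) γ)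
      ≡⟨ ∑-cong (partsF m′ m′ b) (λ ρ → *-assoc (blockWeight (suc b) c) (recip (zee ρ)) _) ⟩
    ∑[ ρ ∈ partsF m′ m′ b ] (blockWeight (suc b) c * (recip (zee ρ) * pMul^ c (suc b) (pCoeffℚ ρ) γ))
      ≡⟨ ∑-*ˡ (partsF m′ m′ b) (blockWeight (suc b) c) _ ⟩
    blockWeight (suc b) c * ∑[ ρ ∈ partsF m′ m′ b ] (recip (zee ρ) * pMul^ c (suc b) (pCoeffℚ ρ) γ)
      ≡⟨ cong (blockWeight (suc b) c *_) (sym (trans
           (pMul^-∑ c (suc b) (partsF m′ m′ b) (λ ρ γ′ → recip (zee ρ) * pCoeffℚ ρ γ′) γ)
           (∑-cong (partsF m′ m′ b) (λ ρ → pMul^-*ˡ c (suc b) (recip (zee ρ)) (pCoeffℚ ρ) γ)))) ⟩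
    blockWeight (suc b) c * pMul^ c (suc b) (cycleIndex b m′) γ ∎
    where
    open ≡-Reasoning
    m′ = m ∸ c ℕ.* suc b

pMul-cycleIndex-blocks : ∀ r b m K γ → m ≤ K → pMul r (cycleIndex (suc b) m) γ ≡
  ∑[ c < suc K ] when (c ℕ.* suc b ≤ᵇ m) (blockWeight (suc b) c * pMul r (pMul^ c (suc b) (cycleIndex b (m ∸ c ℕ.* suc b))) γ)
pMul-cycleIndex-blocks r b m K γ m≤K = begin
  pMul r (cycleIndex (suc b) m) γ
    ≡⟨ pMul-cong r (λ γ′ → cycleIndex-blocks b m K γ′ m≤K) γ ⟩
  pMul r (λ γ′ → ∑[ c < suc K ] when (c ℕ.* suc b ≤ᵇ m) (block c γ′)) γ
    ≡⟨ pMul-∑< r (suc K) (λ c γ′ → when (c ℕ.* suc b ≤ᵇ m) (block c γ′)) γ ⟩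
  ∑[ c < suc K ] pMul r (λ γ′ → when (c ℕ.* suc b ≤ᵇ m) (block c γ′)) γ
    ≡⟨ ∑<-cong (suc K) (λ c _ → trans (pMul-when r (c ℕ.* suc b ≤ᵇ m) (block c) γ)
         (cong (when (c ℕ.* suc b ≤ᵇ m)) (pMul-*ˡ r (blockWeight (suc b) c) (pMul^ c (suc b) (cycleIndex b (m ∸ c ℕ.* suc b))) γ))) ⟩
  ∑[ c < suc K ] when (c ℕ.* suc b ≤ᵇ m) (blockWeight (suc b) c * pMul r (pMul^ c (suc b) (cycleIndex b (m ∸ c ℕ.* suc b))) γ) ∎
  where
  open ≡-Reasoning
  block : ℕ → Coeffs
  block c γ′ = blockWeight (suc b) c * pMul^ c (suc b) (cycleIndex b (m ∸ c ℕ.* suc b)) γ′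

blockWeight-suc : ∀ l c → ℕ→ℚ (suc c ℕ.* suc l) * blockWeight (suc l) (suc c) ≡ blockWeight (suc l) c
blockWeight-suc l c = begin
  ℕ→ℚ k * blockWeight (suc l) (suc c)
    ≡⟨ cong (λ x → ℕ→ℚ k * recip x)
         (solve 4 (λ s f p q → (s :* f) :* (p :* q) := (s :* p) :* (f :* q)) refl (suc c) (c !) (suc l) (suc l ^ c)) ⟩
  ℕ→ℚ k * recip (k ℕ.* (c ! ℕ.* suc l ^ c))
    ≡⟨ cong (ℕ→ℚ k *_) (recip-* k (c ! ℕ.* suc l ^ c)) ⟩
  ℕ→ℚ k * (recip k * blockWeight (suc l) c)
    ≡⟨ sym (*-assoc (ℕ→ℚ k) (recip k) _) ⟩
  ℕ→ℚ k * recip k * blockWeight (suc l) c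
    ≡⟨ cong (_* blockWeight (suc l) c) (ℕ→ℚ*recip k) ⟩
  1ℚ * blockWeight (suc l) c
    ≡⟨ *-identityˡ _ ⟩
  blockWeight (suc l) c ∎
  where
  open ≡-Reasoning
  open ℕSolver.+-*-Solver
  k = suc c ℕ.* suc l

CycleIndexNewton : ℕ → Set
CycleIndexNewton b = ∀ m γ →
  ℕ→ℚ m * cycleIndex b m γ ≡ ∑[ i < m ] when (suc i ≤ᵇ b) (pMul (suc i) (cycleIndex b (m ∸ suc i)) γ)

-- The share c (b+1) of m = c (b+1) + (m - c (b+1)) lowers c by one and gives the new term p_{b+1}.
newton-largest : ∀ b m γ →
  ∑[ c < suc m ] when (c ℕ.* suc b ≤ᵇ m) (ℕ→ℚ (c ℕ.* suc b) * (blockWeight (suc b) c * pMul^ c (suc b) (cycleIndex b (m ∸ c ℕ.* suc b)) γ))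
  ≡ when (suc b ≤ᵇ m) (pMul (suc b) (cycleIndex (suc b) (m ∸ suc b)) γ)
newton-largest b m γ = begin
  0ℚ * none + ∑< m V′
    ≡⟨ trans (cong (_+ ∑< m V′) (*-zeroˡ none)) (+-identityˡ _) ⟩
  ∑[ c < m ] when (suc c ℕ.* B ≤ᵇ m) (ℕ→ℚ (suc c ℕ.* B) * (blockWeight B (suc c) * pMul B (term c) γ))
    ≡⟨ ∑<-cong m (λ c _ → cong (when (suc c ℕ.* B ≤ᵇ m)) (trans (sym (*-assoc (ℕ→ℚ (suc c ℕ.* B)) (blockWeight B (suc c)) (pMul B (term c) γ)))
         (cong (_* pMul B (term c) γ) (blockWeight-suc b c)))) ⟩
  ∑< m V
    ≡⟨ sym (trans (∑<-snoc m V) (trans (cong (∑< m V +_) (when-false _ too-many)) (+-identityʳ (∑< m V)))) ⟩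
  ∑< (suc m) V
    ≡⟨ sym (trans (sym (∑<-when (suc m) (B ≤ᵇ m) W)) (∑<-cong (suc m) (λ c _ →
         trans (when-≤ᵇ-∸ B (c ℕ.* B) m (blockWeight B c * pMul B (pMul^ c B (cycleIndex b (m ∸ B ∸ c ℕ.* B))) γ))
               (cong (λ x → when (B ℕ.+ c ℕ.* B ≤ᵇ m) (blockWeight B c * pMul B (pMul^ c B (cycleIndex b x)) γ))
                     (ℕₚ.∸-+-assoc m B (c ℕ.* B)))))) ⟩
  when (B ≤ᵇ m) (∑[ c < suc m ] when (c ℕ.* B ≤ᵇ m ∸ B) (blockWeight B c * pMul B (pMul^ c B (cycleIndex b (m ∸ B ∸ c ℕ.* B))) γ))
    ≡⟨ cong (when (B ≤ᵇ m)) (sym (pMul-cycleIndex-blocks B b (m ∸ B) m γ (ℕₚ.m∸n≤m m B))) ⟩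
  when (B ≤ᵇ m) (pMul B (cycleIndex B (m ∸ B)) γ) ∎
  where
  open ≡-Reasoning
  B = suc b
  none : ℚ
  none = blockWeight B 0 * cycleIndex b m γ
  term : ℕ → Coeffs
  term c = pMul^ c B (cycleIndex b (m ∸ suc c ℕ.* B))
  V′ : ℕ → ℚ
  V′ c = when (suc c ℕ.* B ≤ᵇ m) (ℕ→ℚ (suc c ℕ.* B) * (blockWeight B (suc c) * pMul B (term c) γ))
  W : ℕ → ℚ
  W c = when (c ℕ.* B ≤ᵇ m ∸ B) (blockWeight B c * pMul B (pMul^ c B (cycleIndex b (m ∸ B ∸ c ℕ.* B))) γ)
  V : ℕ → ℚ
  V c = when (B ℕ.+ c ℕ.* B ≤ᵇ m) (blockWeight B c * pMul B (pMul^ c B (cycleIndex b (m ∸ (B ℕ.+ c ℕ.* B)))) γ)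
  too-many : T (B ℕ.+ m ℕ.* B ≤ᵇ m) → ⊥
  too-many le = ℕₚ.<-irrefl refl (ℕₚ.≤-trans (s≤s (ℕₚ.≤-trans (ℕₚ.m≤m*n m B) (ℕₚ.m≤n+m (m ℕ.* B) b)))
                                             (ℕₚ.≤ᵇ⇒≤ (B ℕ.+ m ℕ.* B) m le))

-- The share m - c (b+1), rewritten by Newton's identity for parts ≤ b, gives the terms p_i with i ≤ b.
newton-smaller : ∀ b → CycleIndexNewton b → ∀ m γ →
  ∑[ c < suc m ] when (c ℕ.* suc b ≤ᵇ m)
      (blockWeight (suc b) c * pMul^ c (suc b) (λ γ′ → ℕ→ℚ (m ∸ c ℕ.* suc b) * cycleIndex b (m ∸ c ℕ.* suc b) γ′) γ)
  ≡ ∑[ i < m ] when (suc i ≤ᵇ b) (pMul (suc i) (cycleIndex (suc b) (m ∸ suc i)) γ)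
newton-smaller b newton m γ = trans (∑<-cong (suc m) (λ c _ → per-block c))
  (trans (∑<-comm (suc m) m (λ c i → when (suc i ≤ᵇ m ∸ c ℕ.* B) (F c i))) (∑<-cong m per-part))
  where
  open ≡-Reasoning
  B = suc b
  F : ℕ → ℕ → ℚ
  F c i = blockWeight B c * when (suc i ≤ᵇ b) (pMul (suc i) (pMul^ c B (cycleIndex b (m ∸ c ℕ.* B ∸ suc i))) γ)
  per-block : ∀ c → when (c ℕ.* B ≤ᵇ m) (blockWeight B c * pMul^ c B (λ γ′ → ℕ→ℚ (m ∸ c ℕ.* B) * cycleIndex b (m ∸ c ℕ.* B) γ′) γ)
                  ≡ ∑[ i < m ] when (suc i ≤ᵇ m ∸ c ℕ.* B) (F c i)
  per-block c = begin
    when (c ℕ.* B ≤ᵇ m) (blockWeight B c * pMul^ c B (λ γ′ → ℕ→ℚ m′ * cycleIndex b m′ γ′) γ)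
      ≡⟨ cong (λ x → when (c ℕ.* B ≤ᵇ m) (blockWeight B c * x)) (begin
           pMul^ c B (λ γ′ → ℕ→ℚ m′ * cycleIndex b m′ γ′) γ
             ≡⟨ pMul^-cong c B (newton m′) γ ⟩
           pMul^ c B (λ γ′ → ∑[ i < m′ ] when (suc i ≤ᵇ b) (pMul (suc i) (cycleIndex b (m′ ∸ suc i)) γ′)) γ
             ≡⟨ pMul^-∑< c B m′ (λ i γ′ → when (suc i ≤ᵇ b) (pMul (suc i) (cycleIndex b (m′ ∸ suc i)) γ′)) γ ⟩
           ∑[ i < m′ ] pMul^ c B (λ γ′ → when (suc i ≤ᵇ b) (pMul (suc i) (cycleIndex b (m′ ∸ suc i)) γ′)) γ
             ≡⟨ ∑<-cong m′ (λ i _ → trans (pMul^-when c B (suc i ≤ᵇ b) (pMul (suc i) (cycleIndex b (m′ ∸ suc i))) γ)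
                  (cong (when (suc i ≤ᵇ b)) (sym (pMul-pMul^ (suc i) c B (cycleIndex b (m′ ∸ suc i)) γ)))) ⟩
           ∑[ i < m′ ] when (suc i ≤ᵇ b) (pMul (suc i) (pMul^ c B (cycleIndex b (m′ ∸ suc i))) γ) ∎) ⟩
    when (c ℕ.* B ≤ᵇ m) (blockWeight B c * ∑[ i < m′ ] when (suc i ≤ᵇ b) (pMul (suc i) (pMul^ c B (cycleIndex b (m′ ∸ suc i))) γ))
      ≡⟨ cong (when (c ℕ.* B ≤ᵇ m)) (sym (∑<-*ˡ m′ (blockWeight B c) _)) ⟩
    when (c ℕ.* B ≤ᵇ m) (∑< m′ (F c))
      ≡⟨ when-∑<-∸ (c ℕ.* B) m (F c) ⟩
    ∑< m′ (F c)
      ≡⟨ sym (∑<-when-< m m′ (F c) (ℕₚ.m∸n≤m m (c ℕ.* B))) ⟩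
    ∑[ i < m ] when (suc i ≤ᵇ m′) (F c i) ∎
    where
    m′ = m ∸ c ℕ.* B
  per-part : ∀ i → i < m → ∑[ c < suc m ] when (suc i ≤ᵇ m ∸ c ℕ.* B) (F c i)
                         ≡ when (suc i ≤ᵇ b) (pMul (suc i) (cycleIndex B (m ∸ suc i)) γ)
  per-part i i<m = begin
    ∑[ c < suc m ] when (suc i ≤ᵇ m ∸ c ℕ.* B) (F c i)
      ≡⟨ ∑<-cong (suc m) (λ c _ → begin
           when (suc i ≤ᵇ m ∸ c ℕ.* B) (blockWeight B c * when (suc i ≤ᵇ b) (G c (m ∸ c ℕ.* B ∸ suc i)))
             ≡⟨ cong (when (suc i ≤ᵇ m ∸ c ℕ.* B)) (sym (when-* (suc i ≤ᵇ b) (blockWeight B c) _)) ⟩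
           when (suc i ≤ᵇ m ∸ c ℕ.* B) (when (suc i ≤ᵇ b) (blockWeight B c * G c (m ∸ c ℕ.* B ∸ suc i)))
             ≡⟨ when-comm (suc i ≤ᵇ m ∸ c ℕ.* B) (suc i ≤ᵇ b) _ ⟩
           when (suc i ≤ᵇ b) (when (suc i ≤ᵇ m ∸ c ℕ.* B) (blockWeight B c * G c (m ∸ c ℕ.* B ∸ suc i)))
             ≡⟨ cong₂ (λ x y → when (suc i ≤ᵇ b) (when x (blockWeight B c * G c y)))
                  (≤ᵇ-∸-swap (c ℕ.* B) i m i<m) (∸-comm m (c ℕ.* B) (suc i)) ⟩
           when (suc i ≤ᵇ b) (when (c ℕ.* B ≤ᵇ m ∸ suc i) (blockWeight B c * G c (m ∸ suc i ∸ c ℕ.* B))) ∎) ⟩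
    ∑[ c < suc m ] when (suc i ≤ᵇ b) (when (c ℕ.* B ≤ᵇ m ∸ suc i) (blockWeight B c * G c (m ∸ suc i ∸ c ℕ.* B)))
      ≡⟨ ∑<-when (suc m) (suc i ≤ᵇ b) (λ c → when (c ℕ.* B ≤ᵇ m ∸ suc i) (blockWeight B c * G c (m ∸ suc i ∸ c ℕ.* B))) ⟩
    when (suc i ≤ᵇ b) (∑[ c < suc m ] when (c ℕ.* B ≤ᵇ m ∸ suc i) (blockWeight B c * G c (m ∸ suc i ∸ c ℕ.* B)))
      ≡⟨ cong (when (suc i ≤ᵇ b)) (sym (pMul-cycleIndex-blocks (suc i) b (m ∸ suc i) m γ (ℕₚ.m∸n≤m m (suc i)))) ⟩
    when (suc i ≤ᵇ b) (pMul (suc i) (cycleIndex B (m ∸ suc i)) γ) ∎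
    where
    G : ℕ → ℕ → ℚ
    G c k = pMul (suc i) (pMul^ c B (cycleIndex b k)) γ
    ∸-comm : ∀ m a s → m ∸ a ∸ s ≡ m ∸ s ∸ a
    ∸-comm m a s = trans (ℕₚ.∸-+-assoc m a s) (trans (cong (m ∸_) (ℕₚ.+-comm a s)) (sym (ℕₚ.∸-+-assoc m s a)))

cycleIndex-newton : ∀ b → CycleIndexNewton b
cycleIndex-newton zero zero    γ = *-zeroˡ (cycleIndex 0 0 γ)
cycleIndex-newton zero (suc n) γ =
  trans (cong (ℕ→ℚ (suc n) *_) (trans (∑Part-suc n 0 (λ μ → recip (zee μ) * pCoeffℚ μ γ)) (∑<-zero (suc n))))
        (trans (*-zeroʳ (ℕ→ℚ (suc n))) (sym (∑<-zero (suc n))))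
cycleIndex-newton (suc b) m γ = begin
  ℕ→ℚ m * cycleIndex B m γ
    ≡⟨ cong (ℕ→ℚ m *_) (cycleIndex-blocks b m m γ ℕₚ.≤-refl) ⟩
  ℕ→ℚ m * ∑[ c < suc m ] when (c ℕ.* B ≤ᵇ m) (block c)
    ≡⟨ sym (∑<-*ˡ (suc m) (ℕ→ℚ m) (λ c → when (c ℕ.* B ≤ᵇ m) (block c))) ⟩
  ∑[ c < suc m ] (ℕ→ℚ m * when (c ℕ.* B ≤ᵇ m) (block c))
    ≡⟨ ∑<-cong (suc m) (λ c _ → trans (sym (when-* (c ℕ.* B ≤ᵇ m) (ℕ→ℚ m) (block c)))
         (trans (when-cong (c ℕ.* B ≤ᵇ m) (λ cB≤m → split c (ℕₚ.≤ᵇ⇒≤ (c ℕ.* B) m cB≤m)))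
                (when-+ (c ℕ.* B ≤ᵇ m) (largest c) (smaller c)))) ⟩
  ∑[ c < suc m ] (when (c ℕ.* B ≤ᵇ m) (largest c) + when (c ℕ.* B ≤ᵇ m) (smaller c))
    ≡⟨ ∑<-+ (suc m) (λ c → when (c ℕ.* B ≤ᵇ m) (largest c)) (λ c → when (c ℕ.* B ≤ᵇ m) (smaller c)) ⟩
  ∑[ c < suc m ] when (c ℕ.* B ≤ᵇ m) (largest c) + ∑[ c < suc m ] when (c ℕ.* B ≤ᵇ m) (smaller c)
    ≡⟨ cong₂ _+_ (newton-largest b m γ) (newton-smaller b (cycleIndex-newton b) m γ) ⟩
  when (B ≤ᵇ m) (Y b) + ∑[ i < m ] when (suc i ≤ᵇ b) (Y i)
    ≡⟨ cong (_+ ∑[ i < m ] when (suc i ≤ᵇ b) (Y i)) (sym (∑<-when-≡ m b Y)) ⟩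
  ∑[ i < m ] when (i ≡ᵇ b) (Y i) + ∑[ i < m ] when (suc i ≤ᵇ b) (Y i)
    ≡⟨ sym (∑<-+ m (λ i → when (i ≡ᵇ b) (Y i)) (λ i → when (suc i ≤ᵇ b) (Y i))) ⟩
  ∑[ i < m ] (when (i ≡ᵇ b) (Y i) + when (suc i ≤ᵇ b) (Y i))
    ≡⟨ sym (∑<-cong m (λ i _ → when-≤-split i b (Y i))) ⟩
  ∑[ i < m ] when (suc i ≤ᵇ B) (Y i) ∎
  where
  open ≡-Reasoning
  B = suc b
  Y : ℕ → ℚ
  Y i = pMul (suc i) (cycleIndex B (m ∸ suc i)) γ
  block : ℕ → ℚ
  block c = blockWeight B c * pMul^ c B (cycleIndex b (m ∸ c ℕ.* B)) γ
  largest : ℕ → ℚ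
  largest c = ℕ→ℚ (c ℕ.* B) * block c
  smaller : ℕ → ℚ
  smaller c = blockWeight B c * pMul^ c B (λ γ′ → ℕ→ℚ (m ∸ c ℕ.* B) * cycleIndex b (m ∸ c ℕ.* B) γ′) γ
  split : ∀ c → c ℕ.* B ≤ m → ℕ→ℚ m * block c ≡ largest c + smaller c
  split c cB≤m = begin
    ℕ→ℚ m * block c
      ≡⟨ cong (λ x → ℕ→ℚ x * block c) (sym (ℕₚ.m+[n∸m]≡n cB≤m)) ⟩
    ℕ→ℚ (c ℕ.* B ℕ.+ m′) * block c
      ≡⟨ cong (_* block c) (ℕ→ℚ-+ (c ℕ.* B) m′) ⟩
    (ℕ→ℚ (c ℕ.* B) + ℕ→ℚ m′) * block c
      ≡⟨ *-distribʳ-+ (block c) (ℕ→ℚ (c ℕ.* B)) (ℕ→ℚ m′) ⟩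
    largest c + ℕ→ℚ m′ * (blockWeight B c * pMul^ c B (cycleIndex b m′) γ)
      ≡⟨ cong (largest c +_) (solve 3 (λ q a p → q :* (a :* p) := a :* (q :* p)) refl (ℕ→ℚ m′) (blockWeight B c) _) ⟩
    largest c + blockWeight B c * (ℕ→ℚ m′ * pMul^ c B (cycleIndex b m′) γ)
      ≡⟨ cong (λ x → largest c + blockWeight B c * x) (sym (pMul^-*ˡ c B (ℕ→ℚ m′) (cycleIndex b m′) γ)) ⟩
    largest c + smaller c ∎
    where
    open +-*-Solver
    m′ = m ∸ c ℕ.* B

cycleIndex-zero : ∀ b γ → cycleIndex b 0 γ ≡ hCoeff 0 γ
cycleIndex-zero b γ = trans (∑Part-zero b (λ μ → recip (zee μ) * pCoeffℚ μ γ))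
  (trans (*-identityˡ (pCoeffℚ [] γ)) (pCoeffℚ-nil γ))
  where
  pCoeffℚ-nil : ∀ γ → pCoeffℚ [] γ ≡ hCoeff 0 γ
  pCoeffℚ-nil []          = refl
  pCoeffℚ-nil (zero ∷ γ)  = pCoeffℚ-nil γ
  pCoeffℚ-nil (suc x ∷ γ) = refl

-- h_m and Σ_{μ ⊢ m} p_μ/z_μ satisfy the same recursion (Newton's identity); the bound
-- m ≤ b makes the restriction to parts ≤ b invisible.
cycleIndex≡hCoeff-≤ : ∀ b m γ → m ≤ b → cycleIndex b m γ ≡ hCoeff m γ
cycleIndex≡hCoeff-≤ b = <-rec Agrees step
  where
  Agrees : ℕ → Set
  Agrees m = ∀ γ → m ≤ b → cycleIndex b m γ ≡ hCoeff m γ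
  step : ∀ m → (∀ {k} → k < m → Agrees k) → Agrees m
  step zero    _   γ _   = cycleIndex-zero b γ
  step (suc n) rec γ m≤b = ℕ→ℚ-suc-cancelˡ n (cycleIndex b (suc n) γ) (hCoeff (suc n) γ) (begin
    ℕ→ℚ (suc n) * cycleIndex b (suc n) γ
      ≡⟨ cycleIndex-newton b (suc n) γ ⟩
    ∑[ i < suc n ] when (suc i ≤ᵇ b) (pMul (suc i) (cycleIndex b (n ∸ i)) γ)
      ≡⟨ ∑<-cong (suc n) (λ i i<m → trans (when-true _ (ℕₚ.≤⇒≤ᵇ (ℕₚ.≤-trans i<m m≤b)))
           (pMul-cong (suc i) (λ γ′ → rec (s≤s (ℕₚ.m∸n≤m n i)) γ′
              (ℕₚ.≤-trans (ℕₚ.m∸n≤m n i) (ℕₚ.≤-trans (ℕₚ.n≤1+n n) m≤b))) γ)) ⟩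
    ∑[ i < suc n ] pMul (suc i) (hCoeff (suc n ∸ suc i)) γ
      ≡⟨ hCoeff-newton (suc n) γ ⟩
    ℕ→ℚ (suc n) * hCoeff (suc n) γ ∎)
    where open ≡-Reasoning

cycleIndex≡hCoeff : ∀ m γ → cycleIndex m m γ ≡ hCoeff m γ
cycleIndex≡hCoeff m γ = cycleIndex≡hCoeff-≤ m m γ ℕₚ.≤-refl

-- Divisibility and partitions into multiples

dvd⇒∣ : ∀ {d m} → T (dvd d m) → d ∣ m
dvd⇒∣ {d} {m} _ with d ∣? m
... | yes d∣m = d∣m

∣⇒dvd : ∀ {d m} → d ∣ m → T (dvd d m)
∣⇒dvd {d} {m} d∣m with d ∣? m
... | yes _  = _
... | no d∤m = d∤m d∣m

allDvd : ℕ → List ℕ → Bool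
allDvd n = all (dvd n)

allDvd⇒All∣ : ∀ n β → T (allDvd n β) → All (n ∣_) β
allDvd⇒All∣ n β n∣β = All.map dvd⇒∣ (all⁺ (dvd n) β n∣β)

All∣⇒allDvd : ∀ n β → All (n ∣_) β → T (allDvd n β)
All∣⇒allDvd n β n∣β = all⁻ (dvd n) (All.map ∣⇒dvd n∣β)

∣gcdList⇔All∣ : ∀ n lam → n ∣ gcdList lam ⇔ All (n ∣_) lam
∣gcdList⇔All∣ n []        = mk⇔ (λ _ → []) (λ _ → n ∣0)
∣gcdList⇔All∣ n (x ∷ lam) = mk⇔
  (λ n∣gcd → ∣-trans n∣gcd (gcd[m,n]∣m x g) ∷ Equivalence.to (∣gcdList⇔All∣ n lam) (∣-trans n∣gcd (gcd[m,n]∣n x g)))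
  (λ { (n∣x ∷ n∣lam) → gcd-greatest n∣x (Equivalence.from (∣gcdList⇔All∣ n lam) n∣lam) })
  where g = gcdList lam

dvd-gcdList : ∀ n lam → dvd n (gcdList lam) ≡ allDvd n lam
dvd-gcdList n lam = T-ext
  (λ n∣gcd → All∣⇒allDvd n lam (Equivalence.to (∣gcdList⇔All∣ n lam) (dvd⇒∣ n∣gcd)))
  (λ n∣lam → ∣⇒dvd (Equivalence.from (∣gcdList⇔All∣ n lam) (allDvd⇒All∣ n lam n∣lam)))

∣sum : ∀ {n} lam → All (n ∣_) lam → n ∣ sum lam
∣sum []        []              = _ ∣0
∣sum (x ∷ lam) (n∣x ∷ n∣lam) = ∣m∣n⇒∣m+n n∣x (∣sum lam n∣lam)

module Scaling (n-1 : ℕ) where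

  n : ℕ
  n = suc n-1

  *≤ᵇ≡≤ᵇ/ : ∀ p x → (n ℕ.* p ≤ᵇ x) ≡ (p ≤ᵇ x ℕ./ n)
  *≤ᵇ≡≤ᵇ/ p x = does-⇔ (mk⇔ to from) (n ℕ.* p ℕ.≤? x) (p ℕ.≤? x ℕ./ n)
    where
    to : n ℕ.* p ≤ x → p ≤ x ℕ./ n
    to np≤x = subst (_≤ x ℕ./ n) (ℕ.m*n/n≡m p n) (ℕ./-monoˡ-≤ n (subst (_≤ x) (ℕₚ.*-comm n p) np≤x))
    from : p ≤ x ℕ./ n → n ℕ.* p ≤ x
    from p≤x/n = ℕₚ.≤-trans (ℕₚ.≤-reflexive (ℕₚ.*-comm n p)) (ℕₚ.≤-trans (ℕₚ.*-monoˡ-≤ n p≤x/n) (ℕ.m/n*n≤m x n))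

  *≤ᵇ* : ∀ a b → (n ℕ.* a ≤ᵇ n ℕ.* b) ≡ (a ≤ᵇ b)
  *≤ᵇ* a b = does-⇔ (mk⇔ (ℕₚ.*-cancelˡ-≤ n) (ℕₚ.*-monoʳ-≤ n)) (n ℕ.* a ℕ.≤? n ℕ.* b) (a ℕ.≤? b)

  [∸*]/ : ∀ p x → (x ∸ n ℕ.* p) ℕ./ n ≡ x ℕ./ n ∸ p
  [∸*]/ p x = trans (cong (λ y → (x ∸ y) ℕ./ n) (ℕₚ.*-comm n p)) (ℕ.[m∸n*o]/o≡m/o∸n x p n)

  dvd-∸* : ∀ p x → n ℕ.* p ≤ x → dvd n (x ∸ n ℕ.* p) ≡ dvd n x
  dvd-∸* p x np≤x = does-⇔ (mk⇔ (λ n∣x∸np → ∣m∸n∣n⇒∣m n np≤x n∣x∸np (m∣m*n p))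
                                (λ n∣x → ∣m+n∣m⇒∣n (subst (n ∣_) (sym (ℕₚ.m+[n∸m]≡n np≤x)) n∣x) (m∣m*n p)))
                           (n ∣? x ∸ n ℕ.* p) (n ∣? x)

  ≡ᵇ0-scale : ∀ x → (x ≡ᵇ 0) ≡ dvd n x ∧ (x ℕ./ n ≡ᵇ 0)
  ≡ᵇ0-scale zero    = sym (trans (cong (_∧ (0 ℕ./ n ≡ᵇ 0)) (T-ext (λ _ → _) (λ _ → ∣⇒dvd (n ∣0))))
                                 (cong (_≡ᵇ 0) (ℕ.0/n≡0 n)))
  ≡ᵇ0-scale (suc x) = T-ext (λ ()) (λ n∣x∧x/n≡0 → ⊥-elim (ℕₚ.1+n≢0 (begin
    suc x                     ≡⟨ sym (ℕ.m/n*n≡m {suc x} {n} (dvd⇒∣ (proj₁ (Equivalence.to (T-∧ {dvd n (suc x)}) n∣x∧x/n≡0)))) ⟩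
    suc x ℕ./ n ℕ.* n         ≡⟨ cong (ℕ._* n) (ℕₚ.≡ᵇ⇒≡ (suc x ℕ./ n) 0 (proj₂ (Equivalence.to (T-∧ {dvd n (suc x)}) n∣x∧x/n≡0))) ⟩
    0                         ∎)))
    where open ≡-Reasoning

  pMul-scale : ∀ p (G : Coeffs) β →
    pMul (n ℕ.* p) (λ β′ → when (allDvd n β′) (G (map (ℕ._/ n) β′))) β ≡ when (allDvd n β) (pMul p G (map (ℕ._/ n) β))
  pMul-scale p G []       = refl
  pMul-scale p G (x ∷ xs) = begin
    pMul (n ℕ.* p) H (x ∷ xs)
      ≡⟨ pMul-cons (n ℕ.* p) H x xs ⟩
    when (n ℕ.* p ≤ᵇ x) (H ((x ∸ n ℕ.* p) ∷ xs)) + pMul (n ℕ.* p) (λ ys → H (x ∷ ys)) xs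
      ≡⟨ cong₂ _+_ lowered-here lowered-later ⟩
    when n∣x∷xs (when (p ≤ᵇ x/n) (G ((x/n ∸ p) ∷ xs/n))) + when n∣x∷xs (pMul p (λ zs → G (x/n ∷ zs)) xs/n)
      ≡⟨ sym (when-+ n∣x∷xs _ _) ⟩
    when n∣x∷xs (when (p ≤ᵇ x/n) (G ((x/n ∸ p) ∷ xs/n)) + pMul p (λ zs → G (x/n ∷ zs)) xs/n)
      ≡⟨ cong (when n∣x∷xs) (sym (pMul-cons p G x/n xs/n)) ⟩
    when n∣x∷xs (pMul p G (map (ℕ._/ n) (x ∷ xs))) ∎
    where
    open ≡-Reasoning
    H : Coeffs
    H β′ = when (allDvd n β′) (G (map (ℕ._/ n) β′))
    x/n = x ℕ./ n
    xs/n = map (ℕ._/ n) xs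
    n∣x∷xs = dvd n x ∧ allDvd n xs
    lowered-here : when (n ℕ.* p ≤ᵇ x) (H ((x ∸ n ℕ.* p) ∷ xs)) ≡ when n∣x∷xs (when (p ≤ᵇ x/n) (G ((x/n ∸ p) ∷ xs/n)))
    lowered-here = begin
      when (n ℕ.* p ≤ᵇ x) (H ((x ∸ n ℕ.* p) ∷ xs))
        ≡⟨ when-cong (n ℕ.* p ≤ᵇ x) (λ np≤x → cong₂ (λ c y → when (c ∧ allDvd n xs) (G (y ∷ xs/n)))
             (dvd-∸* p x (ℕₚ.≤ᵇ⇒≤ (n ℕ.* p) x np≤x)) ([∸*]/ p x)) ⟩
      when (n ℕ.* p ≤ᵇ x) (when n∣x∷xs (G ((x/n ∸ p) ∷ xs/n)))
        ≡⟨ cong (λ c → when c (when n∣x∷xs (G ((x/n ∸ p) ∷ xs/n)))) (*≤ᵇ≡≤ᵇ/ p x) ⟩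
      when (p ≤ᵇ x/n) (when n∣x∷xs (G ((x/n ∸ p) ∷ xs/n)))
        ≡⟨ when-comm (p ≤ᵇ x/n) n∣x∷xs _ ⟩
      when n∣x∷xs (when (p ≤ᵇ x/n) (G ((x/n ∸ p) ∷ xs/n))) ∎
    lowered-later : pMul (n ℕ.* p) (λ ys → H (x ∷ ys)) xs ≡ when n∣x∷xs (pMul p (λ zs → G (x/n ∷ zs)) xs/n)
    lowered-later = begin
      pMul (n ℕ.* p) (λ ys → H (x ∷ ys)) xs
        ≡⟨ pMul-cong (n ℕ.* p) (λ ys → sym (when-∧ (dvd n x) (allDvd n ys) (G (x/n ∷ map (ℕ._/ n) ys)))) xs ⟩
      pMul (n ℕ.* p) (λ ys → when (dvd n x) (when (allDvd n ys) (G (x/n ∷ map (ℕ._/ n) ys)))) xs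
        ≡⟨ pMul-when (n ℕ.* p) (dvd n x) (λ ys → when (allDvd n ys) (G (x/n ∷ map (ℕ._/ n) ys))) xs ⟩
      when (dvd n x) (pMul (n ℕ.* p) (λ ys → when (allDvd n ys) (G (x/n ∷ map (ℕ._/ n) ys))) xs)
        ≡⟨ cong (when (dvd n x)) (pMul-scale p (λ zs → G (x/n ∷ zs)) xs) ⟩
      when (dvd n x) (when (allDvd n xs) (pMul p (λ zs → G (x/n ∷ zs)) xs/n))
        ≡⟨ when-∧ (dvd n x) (allDvd n xs) _ ⟩
      when n∣x∷xs (pMul p (λ zs → G (x/n ∷ zs)) xs/n) ∎

  allZero-scale : ∀ β → all (_≡ᵇ 0) β ≡ allDvd n β ∧ all (_≡ᵇ 0) (map (ℕ._/ n) β)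
  allZero-scale []       = refl
  allZero-scale (x ∷ xs) = trans (cong₂ _∧_ (≡ᵇ0-scale x) (allZero-scale xs))
    (interchange (dvd n x) (x ℕ./ n ≡ᵇ 0) (allDvd n xs) (all (_≡ᵇ 0) (map (ℕ._/ n) xs)))
    where open CommutativeSemigroupProperties (CommutativeMonoid.commutativeSemigroup ∧-commutativeMonoid) using (interchange)

  pCoeffℚ-scale : ∀ μ β → pCoeffℚ (map (n ℕ.*_) μ) β ≡ when (allDvd n β) (pCoeffℚ μ (map (ℕ._/ n) β))
  pCoeffℚ-scale []      β = trans (ℕ→ℚ-if (all (_≡ᵇ 0) β) 1) (trans (cong (λ c → when c 1ℚ) (allZero-scale β))
    (trans (sym (when-∧ (allDvd n β) (all (_≡ᵇ 0) (map (ℕ._/ n) β)) 1ℚ))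
           (cong (when (allDvd n β)) (sym (ℕ→ℚ-if (all (_≡ᵇ 0) (map (ℕ._/ n) β)) 1)))))
  pCoeffℚ-scale (p ∷ μ) β = begin
    pCoeffℚ (n ℕ.* p ∷ map (n ℕ.*_) μ) β
      ≡⟨ pCoeffℚ-cons (n ℕ.* p) (map (n ℕ.*_) μ) β ⟩
    pMul (n ℕ.* p) (pCoeffℚ (map (n ℕ.*_) μ)) β
      ≡⟨ pMul-cong (n ℕ.* p) (pCoeffℚ-scale μ) β ⟩
    pMul (n ℕ.* p) (λ β′ → when (allDvd n β′) (pCoeffℚ μ (map (ℕ._/ n) β′))) β
      ≡⟨ pMul-scale p (pCoeffℚ μ) β ⟩
    when (allDvd n β) (pMul p (pCoeffℚ μ) (map (ℕ._/ n) β))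
      ≡⟨ cong (when (allDvd n β)) (sym (pCoeffℚ-cons p μ (map (ℕ._/ n) β))) ⟩
    when (allDvd n β) (pCoeffℚ (p ∷ μ) (map (ℕ._/ n) β)) ∎
    where open ≡-Reasoning

  ∑<-block-multiple : ∀ q (G : ℕ → ℚ) →
    ∑[ t < n ] when (dvd n (suc (n ℕ.* q ℕ.+ t))) (G (suc (n ℕ.* q ℕ.+ t))) ≡ G (n ℕ.* suc q)
  ∑<-block-multiple q G = begin
    ∑< n F
      ≡⟨ ∑<-snoc n-1 F ⟩
    ∑< n-1 F + F n-1
      ≡⟨ cong₂ _+_ (trans (∑<-cong n-1 (λ t t<n-1 → when-false _ (not-multiple t t<n-1))) (∑<-zero n-1)) last ⟩
    0ℚ + G (n ℕ.* suc q)
      ≡⟨ +-identityˡ _ ⟩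
    G (n ℕ.* suc q) ∎
    where
    open ≡-Reasoning
    F : ℕ → ℚ
    F t = when (dvd n (suc (n ℕ.* q ℕ.+ t))) (G (suc (n ℕ.* q ℕ.+ t)))
    last : F n-1 ≡ G (n ℕ.* suc q)
    last = trans (cong (λ y → when (dvd n y) (G y)) (trans (cong suc (ℕₚ.+-comm (n ℕ.* q) n-1)) (sym (ℕₚ.*-suc n q))))
                 (when-true _ (∣⇒dvd {n} {n ℕ.* suc q} (m∣m*n (suc q))))
    not-multiple : ∀ t → t < n-1 → T (dvd n (suc (n ℕ.* q ℕ.+ t))) → ⊥
    not-multiple t t<n-1 n∣ = ℕₚ.<-irrefl refl (ℕₚ.≤-trans (s≤s t<n-1)
      (∣⇒≤ (∣m+n∣m⇒∣n (subst (n ∣_) (sym (ℕₚ.+-suc (n ℕ.* q) t)) (dvd⇒∣ n∣)) (m∣m*n q))))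

  ∑<-multiples : ∀ q (G : ℕ → ℚ) → ∑[ i < n ℕ.* q ] when (dvd n (suc i)) (G (suc i)) ≡ ∑[ j < q ] G (n ℕ.* suc j)
  ∑<-multiples zero    G = cong (λ t → ∑[ i < t ] when (dvd n (suc i)) (G (suc i))) (ℕₚ.*-zeroʳ n)
  ∑<-multiples (suc q) G = begin
    ∑< (n ℕ.* suc q) F
      ≡⟨ cong (λ t → ∑< t F) (trans (ℕₚ.*-suc n q) (ℕₚ.+-comm n (n ℕ.* q))) ⟩
    ∑< (n ℕ.* q ℕ.+ n) F
      ≡⟨ ∑<-split (n ℕ.* q) n F ⟩
    ∑< (n ℕ.* q) F + ∑[ t < n ] F (n ℕ.* q ℕ.+ t)
      ≡⟨ cong₂ _+_ (∑<-multiples q G) (∑<-block-multiple q G) ⟩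
    ∑[ j < q ] G (n ℕ.* suc j) + G (n ℕ.* suc q)
      ≡⟨ sym (∑<-snoc q (λ j → G (n ℕ.* suc j))) ⟩
    ∑[ j < suc q ] G (n ℕ.* suc j) ∎
    where
    open ≡-Reasoning
    F : ℕ → ℚ
    F i = when (dvd n (suc i)) (G (suc i))

  -- Partitions of n q all of whose parts are divisible by n are exactly n μ for μ ⊢ q.
  ∑Part-scale : ∀ q b (w : List ℕ → ℚ) →
    ∑Part (n ℕ.* q) (n ℕ.* b) (λ lam → when (allDvd n lam) (w lam)) ≡ ∑Part q b (λ μ → w (map (n ℕ.*_) μ))
  ∑Part-scale = <-rec Scales step
    where
    Scales : ℕ → Set
    Scales q = ∀ b (w : List ℕ → ℚ) →
      ∑Part (n ℕ.* q) (n ℕ.* b) (λ lam → when (allDvd n lam) (w lam)) ≡ ∑Part q b (λ μ → w (map (n ℕ.*_) μ))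
    step : ∀ q → (∀ {q′} → q′ < q → Scales q′) → Scales q
    step zero    _   b w = trans (cong (λ t → ∑Part t (n ℕ.* b) (λ lam → when (allDvd n lam) (w lam))) (ℕₚ.*-zeroʳ n))
      (trans (∑Part-zero (n ℕ.* b) (λ lam → when (allDvd n lam) (w lam))) (sym (∑Part-zero b (λ μ → w (map (n ℕ.*_) μ)))))
    step (suc q) rec b w = begin
      ∑Part (suc N) (n ℕ.* b) w′
        ≡⟨ ∑Part-suc N (n ℕ.* b) w′ ⟩
      ∑[ i < suc N ] when (suc i ≤ᵇ n ℕ.* b) (∑Part (N ∸ i) (suc i) (λ ρ → w′ (suc i ∷ ρ)))
        ≡⟨ ∑<-cong (suc N) (λ i _ → trans (cong (when (suc i ≤ᵇ n ℕ.* b)) (first-part (suc i) (N ∸ i)))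
             (when-comm (suc i ≤ᵇ n ℕ.* b) (dvd n (suc i)) _)) ⟩
      ∑[ i < n ℕ.* suc q ] when (dvd n (suc i)) (G (suc i))
        ≡⟨ ∑<-multiples (suc q) G ⟩
      ∑[ j < suc q ] G (n ℕ.* suc j)
        ≡⟨ ∑<-cong (suc q) (λ j j<1+q → cong₂ when (*≤ᵇ* (suc j) b)
             (trans (cong (λ t → ∑Part t (n ℕ.* suc j) (λ ρ → when (allDvd n ρ) (w (n ℕ.* suc j ∷ ρ))))
                          (sym (ℕₚ.*-distribˡ-∸ n (suc q) (suc j))))
                    (rec (s≤s (ℕₚ.m∸n≤m q j)) (suc j) (λ lam → w (n ℕ.* suc j ∷ lam))))) ⟩
      ∑[ j < suc q ] when (suc j ≤ᵇ b) (∑Part (q ∸ j) (suc j) (λ μ → w (map (n ℕ.*_) (suc j ∷ μ))))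
        ≡⟨ sym (∑Part-suc q b (λ μ → w (map (n ℕ.*_) μ))) ⟩
      ∑Part (suc q) b (λ μ → w (map (n ℕ.*_) μ)) ∎
      where
      open ≡-Reasoning
      N = q ℕ.+ n-1 ℕ.* suc q
      w′ : List ℕ → ℚ
      w′ lam = when (allDvd n lam) (w lam)
      G : ℕ → ℚ
      G p = when (p ≤ᵇ n ℕ.* b) (∑Part (n ℕ.* suc q ∸ p) p (λ ρ → when (allDvd n ρ) (w (p ∷ ρ))))
      first-part : ∀ p m → ∑Part m p (λ ρ → w′ (p ∷ ρ)) ≡ when (dvd n p) (∑Part m p (λ ρ → when (allDvd n ρ) (w (p ∷ ρ))))
      first-part p m = trans (∑-cong (partsF m m p) (λ ρ → sym (when-∧ (dvd n p) (allDvd n ρ) (w (p ∷ ρ)))))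
                             (∑-when (partsF m m p) (dvd n p) (λ ρ → when (allDvd n ρ) (w (p ∷ ρ))))

-- Expanding σ over the divisors of gcd λ

σ-as-∑< : ∀ r g k .{{_ : ℕ.NonZero k}} → g ∣ k → ℕ→ℚ (σ r g) ≡ ∑[ i < k ] when (dvd (suc i) g) (ℕ→ℚ (suc i ^ r))
σ-as-∑< r g k g∣k = begin
  ℕ→ℚ (σ r g)
    ≡⟨ ℕ→ℚ-sum-applyUpTo (λ i → if dvd (suc i) g then suc i ^ r else 0) g ⟩
  ∑[ i < g ] ℕ→ℚ (if dvd (suc i) g then suc i ^ r else 0)
    ≡⟨ ∑<-cong g (λ i _ → ℕ→ℚ-if (dvd (suc i) g) (suc i ^ r)) ⟩
  ∑< g F
    ≡⟨ sym (+-identityʳ (∑< g F)) ⟩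
  ∑< g F + 0ℚ
    ≡⟨ cong (∑< g F +_) (sym (trans (∑<-cong (k ∸ g) (λ j _ → when-false _ (too-large j))) (∑<-zero (k ∸ g)))) ⟩
  ∑< g F + ∑[ j < k ∸ g ] F (g ℕ.+ j)
    ≡⟨ sym (∑<-split g (k ∸ g) F) ⟩
  ∑< (g ℕ.+ (k ∸ g)) F
    ≡⟨ cong (λ t → ∑< t F) (ℕₚ.m+[n∸m]≡n (∣⇒≤ g∣k)) ⟩
  ∑< k F ∎
  where
  open ≡-Reasoning
  F : ℕ → ℚ
  F i = when (dvd (suc i) g) (ℕ→ℚ (suc i ^ r))
  g≢0 : g ≢ 0
  g≢0 refl = ℕ.≢-nonZero⁻¹ k (0∣⇒≡0 g∣k)
  too-large : ∀ j → T (dvd (suc (g ℕ.+ j)) g) → ⊥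
  too-large j g+j∣g = ℕₚ.<-irrefl refl (ℕₚ.≤-trans (s≤s (ℕₚ.m≤m+n g j)) (∣⇒≤ {{ℕ.≢-nonZero g≢0}} (dvd⇒∣ g+j∣g)))

HCoeffTerm : List ℕ → List ℕ → ℚ
HCoeffTerm β lam = divℕ (ℤ.+ σ (length lam ∸ 1) (gcdList lam)) (zee lam) * pCoeffℚ lam β

-- The contribution of the divisor d+1 of gcd λ to σ_{ℓ(λ)-1}(gcd λ) / z_λ · p_λ.
divisorTerm : List ℕ → ℕ → List ℕ → ℚ
divisorTerm β d lam = when (allDvd (suc d) lam) (ℕ→ℚ (suc d ^ (length lam ∸ 1)) * recip (zee lam) * pCoeffℚ lam β)

HCoeffTerm-divisors : ∀ k β lam → sum lam ≡ suc k → HCoeffTerm β lam ≡ ∑[ d < suc k ] divisorTerm β d lam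
HCoeffTerm-divisors k β lam lam⊢k = begin
  divℕ (ℤ.+ σ r g) (zee lam) * pCoeffℚ lam β
    ≡⟨ cong (_* pCoeffℚ lam β) (divℕ≡ℕ→ℚ*recip (σ r g) (zee lam)) ⟩
  ℕ→ℚ (σ r g) * recip (zee lam) * pCoeffℚ lam β
    ≡⟨ cong (λ x → x * recip (zee lam) * pCoeffℚ lam β) (σ-as-∑< r g (suc k) g∣k) ⟩
  ∑[ d < suc k ] when (dvd (suc d) g) (ℕ→ℚ (suc d ^ r)) * recip (zee lam) * pCoeffℚ lam β
    ≡⟨ sym (trans (∑<-*ʳ (suc k) (pCoeffℚ lam β) (λ d → D d * recip (zee lam)))
                  (cong (_* pCoeffℚ lam β) (∑<-*ʳ (suc k) (recip (zee lam)) D))) ⟩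
  ∑[ d < suc k ] (when (dvd (suc d) g) (ℕ→ℚ (suc d ^ r)) * recip (zee lam) * pCoeffℚ lam β)
    ≡⟨ ∑<-cong (suc k) (λ d _ → trans (cong (_* pCoeffℚ lam β) (when-*ʳ (dvd (suc d) g) (ℕ→ℚ (suc d ^ r)) (recip (zee lam))))
         (trans (when-*ʳ (dvd (suc d) g) (ℕ→ℚ (suc d ^ r) * recip (zee lam)) (pCoeffℚ lam β))
                (cong (λ c → when c (ℕ→ℚ (suc d ^ r) * recip (zee lam) * pCoeffℚ lam β)) (dvd-gcdList (suc d) lam)))) ⟩
  ∑[ d < suc k ] divisorTerm β d lam ∎
  where
  open ≡-Reasoning
  r = length lam ∸ 1
  g = gcdList lam
  D : ℕ → ℚ
  D d = when (dvd (suc d) g) (ℕ→ℚ (suc d ^ r))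
  g∣k : g ∣ suc k
  g∣k = subst (g ∣_) lam⊢k (∣sum lam (Equivalence.to (∣gcdList⇔All∣ g lam) ∣-refl))
  when-*ʳ : ∀ c x y → when c x * y ≡ when c (x * y)
  when-*ʳ true  x y = refl
  when-*ʳ false x y = *-zeroˡ y

divisorTerm-scale : ∀ d β μ → μ ≢ [] → All (1 ≤_) μ →
  ℕ→ℚ (suc d ^ (length (map (suc d ℕ.*_) μ) ∸ 1)) * recip (zee (map (suc d ℕ.*_) μ)) * pCoeffℚ (map (suc d ℕ.*_) μ) β
  ≡ when (allDvd (suc d) β) (recip (suc d) * (recip (zee μ) * pCoeffℚ μ (map (ℕ._/ suc d) β)))
divisorTerm-scale d β []          μ≢[] _   = ⊥-elim (μ≢[] refl)
divisorTerm-scale d β μ@(_ ∷ μ′) _    μ≥1 = begin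
  ℕ→ℚ (n ^ (length (map (n ℕ.*_) μ) ∸ 1)) * recip (zee (map (n ℕ.*_) μ)) * pCoeffℚ (map (n ℕ.*_) μ) β
    ≡⟨ cong₂ (λ l z → ℕ→ℚ (n ^ (l ∸ 1)) * recip z * pCoeffℚ (map (n ℕ.*_) μ) β)
         (Listₚ.length-map (n ℕ.*_) μ) (zee-scale d μ μ≥1) ⟩
  ℕ→ℚ (n ^ ℓ) * recip (n ℕ.* n ^ ℓ ℕ.* zee μ) * pCoeffℚ (map (n ℕ.*_) μ) β
    ≡⟨ cong₂ (λ u v → ℕ→ℚ (n ^ ℓ) * u * v)
         (trans (recip-* (n ℕ.* n ^ ℓ) (zee μ)) (cong (_* recip (zee μ)) (recip-* n (n ^ ℓ))))
         (Scaling.pCoeffℚ-scale d μ β) ⟩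
  ℕ→ℚ (n ^ ℓ) * (recip n * recip (n ^ ℓ) * recip (zee μ)) * when n∣β (pCoeffℚ μ β′)
    ≡⟨ solve 5 (λ a b c e f → a :* (c :* b :* e) :* f := (a :* b) :* (c :* (e :* f))) refl
         (ℕ→ℚ (n ^ ℓ)) (recip (n ^ ℓ)) (recip n) (recip (zee μ)) (when n∣β (pCoeffℚ μ β′)) ⟩
  (ℕ→ℚ (n ^ ℓ) * recip (n ^ ℓ)) * (recip n * (recip (zee μ) * when n∣β (pCoeffℚ μ β′)))
    ≡⟨ cong (_* (recip n * (recip (zee μ) * when n∣β (pCoeffℚ μ β′)))) (ℕ→ℚ*recip (n ^ ℓ) {{ℕₚ.m^n≢0 n ℓ}}) ⟩
  1ℚ * (recip n * (recip (zee μ) * when n∣β (pCoeffℚ μ β′)))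
    ≡⟨ *-identityˡ _ ⟩
  recip n * (recip (zee μ) * when n∣β (pCoeffℚ μ β′))
    ≡⟨ sym (trans (when-* n∣β (recip n) _) (cong (recip n *_) (when-* n∣β (recip (zee μ)) (pCoeffℚ μ β′)))) ⟩
  when n∣β (recip n * (recip (zee μ) * pCoeffℚ μ β′)) ∎
  where
  open ≡-Reasoning
  open +-*-Solver
  n = suc d
  ℓ = length μ′
  n∣β = allDvd n β
  β′ = map (ℕ._/ n) β

-- Only the divisors d+1 of k contribute, through the partitions (d+1)μ with μ ⊢ k/(d+1); these
-- sum to h_{k/(d+1)}(X^{d+1}) / (d+1).
∑Part-divisorTerm : ∀ k d β → ∑Part (suc k) (suc k) (divisorTerm β d) ≡
  recip (suc d) * when (dvd (suc d) (suc k) ∧ allDvd (suc d) β) (Ω₀tX (suc k ℕ./ suc d) (map (ℕ._/ suc d) β))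
∑Part-divisorTerm k d β with dvd (suc d) (suc k) in d∣k?
... | false = trans (∑Part-cong (suc k) (suc k) (λ lam lam⊢ → when-false _ (λ d∣lam → subst T d∣k?
          (∣⇒dvd (subst (suc d ∣_) (IsPartition.sum≡ lam⊢) (∣sum lam (allDvd⇒All∣ (suc d) lam d∣lam)))))))
    (trans (∑-zero (partsF (suc k) (suc k) (suc k))) (sym (*-zeroʳ (recip (suc d)))))
... | true with dvd⇒∣ {suc d} {suc k} (subst T (sym d∣k?) _)
...   | divides zero    k≡0 = ⊥-elim (ℕₚ.1+n≢0 k≡0)
...   | divides (suc q) k≡q*n = begin
  ∑Part (suc k) (suc k) (divisorTerm β d)
    ≡⟨ cong (λ t → ∑Part t t (divisorTerm β d)) (trans k≡q*n (ℕₚ.*-comm (suc q) n)) ⟩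
  ∑Part (n ℕ.* suc q) (n ℕ.* suc q) (λ lam → when (allDvd n lam) (w lam))
    ≡⟨ Scaling.∑Part-scale d (suc q) (suc q) w ⟩
  ∑Part (suc q) (suc q) (λ μ → w (map (n ℕ.*_) μ))
    ≡⟨ ∑Part-cong (suc q) (suc q) (λ μ μ⊢ → divisorTerm-scale d β μ
         (λ { refl → ℕₚ.1+n≢0 (sym (IsPartition.sum≡ μ⊢)) }) (IsPartition.parts≥1 μ⊢)) ⟩
  ∑Part (suc q) (suc q) (λ μ → when n∣β (recip n * (recip (zee μ) * pCoeffℚ μ β′)))
    ≡⟨ trans (∑-when (partsF (suc q) (suc q) (suc q)) n∣β _)
             (cong (when n∣β) (∑-*ˡ (partsF (suc q) (suc q) (suc q)) (recip n) _)) ⟩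
  when n∣β (recip n * cycleIndex (suc q) (suc q) β′)
    ≡⟨ cong (λ x → when n∣β (recip n * x)) (cycleIndex≡hCoeff (suc q) β′) ⟩
  when n∣β (recip n * hCoeff (suc q) β′)
    ≡⟨ when-* n∣β (recip n) (hCoeff (suc q) β′) ⟩
  recip n * when n∣β (hCoeff (suc q) β′)
    ≡⟨ cong (λ t → recip n * when n∣β (Ω₀tX t β′)) (sym (trans (cong (ℕ._/ n) k≡q*n) (ℕ.m*n/n≡m (suc q) n))) ⟩
  recip n * when n∣β (Ω₀tX (suc k ℕ./ n) β′) ∎
  where
  open ≡-Reasoning
  n = suc d
  n∣β = allDvd n β
  β′ = map (ℕ._/ n) β
  w : List ℕ → ℚ
  w lam = ℕ→ℚ (n ^ (length lam ∸ 1)) * recip (zee lam) * pCoeffℚ lam β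

mainTheorem10 : (k : ℕ) (β : List ℕ) → LHS k β ≡ RHS k β
mainTheorem10 zero    β = refl
mainTheorem10 (suc k) β = sym (begin
  RHS (suc k) β
    ≡⟨ ∑Part-cong (suc k) (suc k) (λ lam lam⊢ → HCoeffTerm-divisors k β lam (IsPartition.sum≡ lam⊢)) ⟩
  ∑[ lam ∈ partitions (suc k) ] ∑[ d < suc k ] divisorTerm β d lam
    ≡⟨ sym (∑<-∑-comm (suc k) (partitions (suc k)) (λ d lam → divisorTerm β d lam)) ⟩
  ∑[ d < suc k ] ∑Part (suc k) (suc k) (divisorTerm β d)
    ≡⟨ ∑<-cong (suc k) (λ d _ → ∑Part-divisorTerm k d β) ⟩
  LHS (suc k) β ∎)
  where open ≡-Reasoning
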